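{- Let $q$ be an odd prime power with $q\equiv 2\pmod 3$. If $D,F$ are monic polynomials in $\mathbb{F}_q[T]$ with $\gcd(D,F)=1$, then $\chi_D(F)=1$.
   Context: Fix an isomorphism $\Omega$ between the group of cube roots of unity in $\mathbb{C}^*$ and the cube roots of unity in $\mathbb{F}_{q^2}^*$. For a monic irreducible $\pi\in\mathbb{F}_{q^2}[T]$ and $a\in\mathbb{F}_{q^2}[T]$, define $\chi_\pi(a)=0$ if $\pi\mid a$, and otherwise $\chi_\pi(a)=\alpha$, where $\alpha$ is the unique cube root of unity in $\mathbb{C}$ with $a^{(q^{2\deg\pi}-1)/3}\equiv\Omega(\alpha)\pmod{\pi}$. For a monic $G\in\mathbb{F}_{q^2}[T]$ with factorization $G=\pi_1^{e_1}\cdots\pi_s^{e_s}$ into distinct monic irreducibles of $\mathbb{F}_{q^2}[T]$, set $\chi_G=\chi_{\pi_1}^{e_1}\cdots\chi_{\pi_s}^{e_s}$. Polynomials in $\mathbb{F}_q[T]$ are regarded as elements of $\mathbb{F}_{q^2}[T]$, so $\chi_D(F)$ is defined for monic $D,F\in\mathbb{F}_q[T]$. -}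

module Defs where

open import Level using (0ℓ)
open import Algebra.Bundles using (CommutativeRing)
open import Data.Nat as ℕ using (ℕ; zero; suc; _≤_; _<_; _∸_)
open import Data.Nat.DivMod using (_/_)
open import Data.Nat.Primality using (Prime)
open import Data.Fin using (Fin)
open import Data.List using (List; []; _∷_; map; foldr)
open import Data.List.Relation.Unary.All using (All)
open import Data.List.Relation.Unary.AllPairs using (AllPairs)
open import Data.Product using (Σ; ∃; _×_; _,_)
open import Data.Sum using (_⊎_)
open import Relation.Nullary using (¬_)
open import Relation.Binary.PropositionalEquality as ≡ using (_≡_)
open import Function.Bundles using (Inverse)

IsPrimePower : ℕ → Set
IsPrimePower q = Σ ℕ λ p → Σ ℕ λ k → Prime p × 1 ≤ k × q ≡ p ℕ.^ k

record FiniteField (n : ℕ) : Set₁ where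
  field
    cring : CommutativeRing 0ℓ 0ℓ
  open CommutativeRing cring public
  field
    0≉1      : ¬ (0# ≈ 1#)
    inverse  : ∀ x → ¬ (x ≈ 0#) → Σ Carrier λ y → x * y ≈ 1#
    counting : Inverse setoid (≡.setoid (Fin n))

-- Polynomials with coefficients in a commutative ring, as coefficient lists
-- (lowest degree first); equality is coefficientwise.
module Poly (R : CommutativeRing 0ℓ 0ℓ) where
  open CommutativeRing R

  Pol : Set
  Pol = List Carrier

  coeff : Pol → ℕ → Carrier
  coeff []      _       = 0#
  coeff (a ∷ p) zero    = a
  coeff (a ∷ p) (suc n) = coeff p n

  _≈ₚ_ : Pol → Pol → Set
  p ≈ₚ r = ∀ n → coeff p n ≈ coeff r n

  _+ₚ_ : Pol → Pol → Pol
  []      +ₚ r       = r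
  (a ∷ p) +ₚ []      = a ∷ p
  (a ∷ p) +ₚ (b ∷ r) = (a + b) ∷ (p +ₚ r)

  _*ₚ_ : Pol → Pol → Pol
  []      *ₚ r = []
  (a ∷ p) *ₚ r = map (a *_) r +ₚ (0# ∷ (p *ₚ r))

  -ₚ_ : Pol → Pol
  -ₚ p = map (-_) p

  _-ₚ_ : Pol → Pol → Pol
  p -ₚ r = p +ₚ (-ₚ r)

  const : Carrier → Pol
  const c = c ∷ []

  _^ₚ_ : Pol → ℕ → Pol
  p ^ₚ zero  = const 1#
  p ^ₚ suc n = p *ₚ (p ^ₚ n)

  _^ᵣ_ : Carrier → ℕ → Carrier
  x ^ᵣ zero  = 1#
  x ^ᵣ suc n = x * (x ^ᵣ n)

  _∣ₚ_ : Pol → Pol → Set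
  g ∣ₚ p = Σ Pol λ h → p ≈ₚ (g *ₚ h)

  MonicOfDeg : ℕ → Pol → Set
  MonicOfDeg d p = (coeff p d ≈ 1#) × (∀ n → d < n → coeff p n ≈ 0#)

  Monic : Pol → Set
  Monic p = Σ ℕ λ d → MonicOfDeg d p

  IsConstant : Pol → Set
  IsConstant p = ∀ n → 1 ≤ n → coeff p n ≈ 0#

  MonicIrreducible : ℕ → Pol → Set
  MonicIrreducible d π =
    1 ≤ d × MonicOfDeg d π ×
    (∀ g h → π ≈ₚ (g *ₚ h) → IsConstant g ⊎ IsConstant h)

  -- Subfield F_q = { x | x^q = x } of R (R = F_{q^2}) and F_q[T] ⊆ R[T]

  InFq : ℕ → Carrier → Set
  InFq q x = (x ^ᵣ q) ≈ x

  PolFq : ℕ → Pol → Set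
  PolFq q p = All (InFq q) p

  DividesFq : ℕ → Pol → Pol → Set
  DividesFq q g p = Σ Pol λ h → PolFq q h × p ≈ₚ (g *ₚ h)

  CoprimeFq : ℕ → Pol → Pol → Set
  CoprimeFq q D F =
    ∀ g → PolFq q g → DividesFq q g D → DividesFq q g F → IsConstant g

  -- Cubic residue symbol.  Values of χ are represented through Ω (extended
  -- by 0 ↦ 0): χ_π(a) corresponds to ω ∈ R with ω = 0 or ω³ = 1.

  ChiPi : ℕ → ℕ → Pol → Pol → Carrier → Set
  ChiPi q d π a ω =
    (π ∣ₚ a × ω ≈ 0#) ⊎
    (¬ (π ∣ₚ a) × (ω ^ᵣ 3) ≈ 1# ×
      π ∣ₚ ((a ^ₚ ((q ℕ.^ (2 ℕ.* d) ∸ 1) / 3)) -ₚ const ω))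

  record Entry : Set where
    constructor entry
    field
      deg : ℕ
      fac : Pol
      ex  : ℕ
      val : Carrier

  open Entry public

  IsFactorization : Pol → List Entry → Set
  IsFactorization G es =
    All (λ e → MonicIrreducible (deg e) (fac e) × 1 ≤ ex e) es ×
    AllPairs (λ e e′ → ¬ (fac e ≈ₚ fac e′)) es ×
    G ≈ₚ foldr (λ e acc → (fac e ^ₚ ex e) *ₚ acc) (const 1#) es

  -- Ω(χ_G(a)) = ∏ Ω(χ_{π_i}(a))^{e_i}
  chiProduct : List Entry → Carrier
  chiProduct es = foldr (λ e acc → (val e ^ᵣ ex e) * acc) 1# es

  ChiValues : ℕ → Pol → List Entry → Set
  ChiValues q a es = All (λ e → ChiPi q (deg e) (fac e) a (val e)) es

{-# OPTIONS --safe #-}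
-- Let σ x = x^q be the Frobenius of F_{q²} over F_q, applied coefficientwise to
-- F_{q²}[T]; it is a ring automorphism of order 2 (by (x + y)^p = x^p + y^p in
-- characteristic p and x^{q²} = x) whose fixed ring is F_q[T]. For F ∈ F_q[T],
-- applying σ to F^E ≡ χ_π(F) (mod π) gives χ_{σπ}(F) = σ(χ_π(F)) = χ_π(F)², as
-- q ≡ 2 (mod 3). Coprimality of D and F in F_q[T] gives π ∤ F for every
-- irreducible factor π of D, since π, or π σπ, lies in F_q[T] and would divide
-- both; so all these χ_π(F) are cube roots of unity. Finally, D = σD, so the
-- irreducible factors of D, counted with multiplicity, are either self-conjugate,
-- with χ = χ² and hence χ = 1, or come in pairs π, σπ contributing χ χ² = 1.
module Submission where

open import Defs
open import Data.Nat using (ℕ)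
open import Data.Nat.DivMod using (_%_)
open import Data.List using (List)
open import Relation.Binary.PropositionalEquality using (_≡_)

open import Level using (0ℓ)
open import Algebra.Bundles using (CommutativeRing; CommutativeMonoid)
open import Data.Nat as ℕ using (zero; suc; _≤_; _<_; z≤n; s≤s)
import Data.Nat.Properties as ℕ
open import Data.Nat.DivMod using (_/_; m≡m%n+[m/n]*n)
open import Data.Nat.Primality using (Prime; euclidsLemma; ¬prime[0]; ¬prime[1])
open import Data.Integer as ℤ using (ℤ; +_; -[1+_]; _⊖_)
import Data.Integer.Properties as ℤ
open import Data.Fin as Fin using (Fin)
import Data.Fin.Properties as Fin
open import Data.Fin.Permutation using (Permutation; permutation)
open import Data.List using ([]; _∷_; map; length; replicate; _++_; foldr)
import Data.List.Properties as List
open import Data.List.Relation.Unary.All as All using (All; []; _∷_; lookupAny)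
open import Data.List.Relation.Unary.All.Properties using (─⁺; ++⁺; replicate⁺)
open import Data.List.Relation.Unary.Any as Any using (Any; here; there; _─_)
open import Data.Maybe using (just; nothing)
open import Data.Product using (Σ; _,_; proj₁; proj₂)
open import Data.Sum using (_⊎_; inj₁; inj₂)
open import Data.Empty using (⊥-elim)
open import Function.Bundles using (Inverse)
open import Relation.Nullary using (¬_; Dec; yes; no)
open import Relation.Binary.Bundles using (Setoid)
open import Relation.Binary.Structures using (IsEquivalence)
open import Relation.Binary.Definitions using (Decidable; WeaklyDecidable; tri<; tri≈; tri>)
import Relation.Binary.PropositionalEquality as ≡
import Relation.Binary.Reasoning.Setoid
import Algebra.Properties.CommutativeMonoid.Sum as Sum

module PolynomialRing (R : CommutativeRing 0ℓ 0ℓ) where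
  open CommutativeRing R
  open Poly R public
  open import Algebra.Properties.Ring ring using (-0#≈0#)
  open import Algebra.Properties.CommutativeSemigroup +-commutativeSemigroup using (interchange)

  -- A record wrapper around _≈ₚ_, so that both polynomials can be inferred from a proof.
  infix 4 _≋_
  record _≋_ (p r : Pol) : Set where
    constructor mk≋
    field at : ∀ n → coeff p n ≈ coeff r n
  open _≋_ public

  ≋-refl : ∀ {p} → p ≋ p
  ≋-refl = mk≋ λ _ → refl

  ≋-sym : ∀ {p r} → p ≋ r → r ≋ p
  ≋-sym e = mk≋ λ n → sym (at e n)

  ≋-trans : ∀ {p r s} → p ≋ r → r ≋ s → p ≋ s
  ≋-trans e f = mk≋ λ n → trans (at e n) (at f n)

  ≋-isEquivalence : IsEquivalence _≋_
  ≋-isEquivalence = record { refl = ≋-refl ; sym = ≋-sym ; trans = ≋-trans }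

  ≋-setoid : Setoid 0ℓ 0ℓ
  ≋-setoid = record { isEquivalence = ≋-isEquivalence }

  module ≋-Reasoning = Relation.Binary.Reasoning.Setoid ≋-setoid
  module ≈-Reasoning = Relation.Binary.Reasoning.Setoid setoid

  shift : Pol → Pol
  shift p = 0# ∷ p

  tailₚ : Pol → Pol
  tailₚ []      = []
  tailₚ (_ ∷ p) = p

  infixr 8 _·_
  _·_ : Carrier → Pol → Pol
  c · p = map (c *_) p

  ∷-cong : ∀ {a b p r} → a ≈ b → p ≋ r → (a ∷ p) ≋ (b ∷ r)
  ∷-cong e f = mk≋ λ { zero → e ; (suc n) → at f n }

  coeff-+ₚ : ∀ p r n → coeff (p +ₚ r) n ≈ coeff p n + coeff r n
  coeff-+ₚ []      r       n       = sym (+-identityˡ _)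
  coeff-+ₚ (a ∷ p) []      n       = sym (+-identityʳ _)
  coeff-+ₚ (a ∷ p) (b ∷ r) zero    = refl
  coeff-+ₚ (a ∷ p) (b ∷ r) (suc n) = coeff-+ₚ p r n

  coeff-· : ∀ c p n → coeff (c · p) n ≈ c * coeff p n
  coeff-· c []      n       = sym (zeroʳ c)
  coeff-· c (a ∷ p) zero    = refl
  coeff-· c (a ∷ p) (suc n) = coeff-· c p n

  coeff-negₚ : ∀ p n → coeff (-ₚ p) n ≈ - coeff p n
  coeff-negₚ []      n       = sym -0#≈0#
  coeff-negₚ (a ∷ p) zero    = refl
  coeff-negₚ (a ∷ p) (suc n) = coeff-negₚ p n

  coeff-tailₚ : ∀ p n → coeff (tailₚ p) n ≈ coeff p (suc n)
  coeff-tailₚ []      n = refl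
  coeff-tailₚ (a ∷ p) n = refl

  coeff-*ₚ-zero : ∀ p r → coeff (p *ₚ r) 0 ≈ coeff p 0 * coeff r 0
  coeff-*ₚ-zero []      r = sym (zeroˡ _)
  coeff-*ₚ-zero (a ∷ p) r =
    trans (coeff-+ₚ (a · r) (shift (p *ₚ r)) 0) (trans (+-identityʳ _) (coeff-· a r 0))

  coeff-*ₚ-suc : ∀ p r n →
    coeff (p *ₚ r) (suc n) ≈ coeff p 0 * coeff r (suc n) + coeff (tailₚ p *ₚ r) n
  coeff-*ₚ-suc []      r n = sym (trans (+-identityʳ _) (zeroˡ _))
  coeff-*ₚ-suc (a ∷ p) r n =
    trans (coeff-+ₚ (a · r) (shift (p *ₚ r)) (suc n)) (+-congʳ (coeff-· a r (suc n)))

  +ₚ-cong : ∀ {p p′ r r′} → p ≋ p′ → r ≋ r′ → (p +ₚ r) ≋ (p′ +ₚ r′)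
  +ₚ-cong {p} {p′} {r} {r′} e f = mk≋ λ n →
    trans (coeff-+ₚ p r n) (trans (+-cong (at e n) (at f n)) (sym (coeff-+ₚ p′ r′ n)))

  +ₚ-comm : ∀ p r → (p +ₚ r) ≋ (r +ₚ p)
  +ₚ-comm p r = mk≋ λ n → trans (coeff-+ₚ p r n) (trans (+-comm _ _) (sym (coeff-+ₚ r p n)))

  +ₚ-assoc : ∀ p r s → ((p +ₚ r) +ₚ s) ≋ (p +ₚ (r +ₚ s))
  +ₚ-assoc p r s = mk≋ λ n → begin
    coeff ((p +ₚ r) +ₚ s) n              ≈⟨ coeff-+ₚ (p +ₚ r) s n ⟩
    coeff (p +ₚ r) n + coeff s n         ≈⟨ +-congʳ (coeff-+ₚ p r n) ⟩
    (coeff p n + coeff r n) + coeff s n  ≈⟨ +-assoc _ _ _ ⟩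
    coeff p n + (coeff r n + coeff s n)  ≈⟨ +-congˡ (coeff-+ₚ r s n) ⟨
    coeff p n + coeff (r +ₚ s) n         ≈⟨ coeff-+ₚ p (r +ₚ s) n ⟨
    coeff (p +ₚ (r +ₚ s)) n              ∎
    where open ≈-Reasoning

  +ₚ-identityʳ : ∀ p → (p +ₚ []) ≋ p
  +ₚ-identityʳ p = mk≋ λ n → trans (coeff-+ₚ p [] n) (+-identityʳ _)

  +ₚ-interchange : ∀ a b c d → ((a +ₚ b) +ₚ (c +ₚ d)) ≋ ((a +ₚ c) +ₚ (b +ₚ d))
  +ₚ-interchange a b c d = mk≋ λ n → trans
    (trans (coeff-+ₚ (a +ₚ b) (c +ₚ d) n) (+-cong (coeff-+ₚ a b n) (coeff-+ₚ c d n)))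
    (trans (interchange _ _ _ _)
      (sym (trans (coeff-+ₚ (a +ₚ c) (b +ₚ d) n) (+-cong (coeff-+ₚ a c n) (coeff-+ₚ b d n)))))

  -ₚ-cong : ∀ {p r} → p ≋ r → (-ₚ p) ≋ (-ₚ r)
  -ₚ-cong {p} {r} e = mk≋ λ n →
    trans (coeff-negₚ p n) (trans (-‿cong (at e n)) (sym (coeff-negₚ r n)))

  -ₚ-inverseˡ : ∀ p → ((-ₚ p) +ₚ p) ≋ []
  -ₚ-inverseˡ p = mk≋ λ n →
    trans (coeff-+ₚ (-ₚ p) p n) (trans (+-congʳ (coeff-negₚ p n)) (-‿inverseˡ _))

  -ₚ-inverseʳ : ∀ p → (p +ₚ (-ₚ p)) ≋ []
  -ₚ-inverseʳ p = ≋-trans (+ₚ-comm p (-ₚ p)) (-ₚ-inverseˡ p)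

  ·-congˡ : ∀ c {p r} → p ≋ r → (c · p) ≋ (c · r)
  ·-congˡ c {p} {r} e = mk≋ λ n →
    trans (coeff-· c p n) (trans (*-congˡ (at e n)) (sym (coeff-· c r n)))

  ·-congʳ : ∀ {c d} p → c ≈ d → (c · p) ≋ (d · p)
  ·-congʳ {c} {d} p e = mk≋ λ n →
    trans (coeff-· c p n) (trans (*-congʳ e) (sym (coeff-· d p n)))

  ·-distribˡ-+ₚ : ∀ c p r → (c · (p +ₚ r)) ≋ ((c · p) +ₚ (c · r))
  ·-distribˡ-+ₚ c p r = mk≋ λ n → begin
    coeff (c · (p +ₚ r)) n             ≈⟨ coeff-· c (p +ₚ r) n ⟩
    c * coeff (p +ₚ r) n               ≈⟨ *-congˡ (coeff-+ₚ p r n) ⟩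
    c * (coeff p n + coeff r n)        ≈⟨ distribˡ _ _ _ ⟩
    c * coeff p n + c * coeff r n      ≈⟨ +-cong (coeff-· c p n) (coeff-· c r n) ⟨
    coeff (c · p) n + coeff (c · r) n  ≈⟨ coeff-+ₚ (c · p) (c · r) n ⟨
    coeff ((c · p) +ₚ (c · r)) n       ∎
    where open ≈-Reasoning

  ·-distribʳ-+ : ∀ c d p → ((c + d) · p) ≋ ((c · p) +ₚ (d · p))
  ·-distribʳ-+ c d p = mk≋ λ n → begin
    coeff ((c + d) · p) n              ≈⟨ coeff-· (c + d) p n ⟩
    (c + d) * coeff p n                ≈⟨ distribʳ _ _ _ ⟩
    c * coeff p n + d * coeff p n      ≈⟨ +-cong (coeff-· c p n) (coeff-· d p n) ⟨
    coeff (c · p) n + coeff (d · p) n  ≈⟨ coeff-+ₚ (c · p) (d · p) n ⟨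
    coeff ((c · p) +ₚ (d · p)) n       ∎
    where open ≈-Reasoning

  ·-assoc : ∀ c d p → ((c * d) · p) ≋ (c · (d · p))
  ·-assoc c d p = mk≋ λ n → trans (coeff-· (c * d) p n) (trans (*-assoc _ _ _)
    (trans (*-congˡ (sym (coeff-· d p n))) (sym (coeff-· c (d · p) n))))

  ·-identityˡ : ∀ p → (1# · p) ≋ p
  ·-identityˡ p = mk≋ λ n → trans (coeff-· 1# p n) (*-identityˡ _)

  ·-zeroˡ : ∀ p → (0# · p) ≋ []
  ·-zeroˡ p = mk≋ λ n → trans (coeff-· 0# p n) (zeroˡ _)

  shift-cong : ∀ {p r} → p ≋ r → shift p ≋ shift r
  shift-cong = ∷-cong refl

  shift-+ₚ : ∀ p r → shift (p +ₚ r) ≋ (shift p +ₚ shift r)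
  shift-+ₚ p r = ∷-cong (sym (+-identityʳ _)) ≋-refl

  ·-shift : ∀ c p → (c · shift p) ≋ shift (c · p)
  ·-shift c p = ∷-cong (zeroʳ c) ≋-refl

  shift-[] : shift [] ≋ []
  shift-[] = mk≋ λ { zero → refl ; (suc n) → refl }

  *ₚ-congʳ : ∀ {p p′} r → p ≋ p′ → (p *ₚ r) ≋ (p′ *ₚ r)
  *ₚ-congʳ {p} {p′} r e = mk≋ (pointwise p p′ (at e))
    where
    pointwise : ∀ p p′ → (∀ n → coeff p n ≈ coeff p′ n) → ∀ n → coeff (p *ₚ r) n ≈ coeff (p′ *ₚ r) n
    pointwise p p′ e zero    = trans (coeff-*ₚ-zero p r) (trans (*-congʳ (e 0)) (sym (coeff-*ₚ-zero p′ r)))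
    pointwise p p′ e (suc n) = trans (coeff-*ₚ-suc p r n)
      (trans (+-cong (*-congʳ (e 0)) (pointwise (tailₚ p) (tailₚ p′) e′ n)) (sym (coeff-*ₚ-suc p′ r n)))
      where
      e′ : ∀ m → coeff (tailₚ p) m ≈ coeff (tailₚ p′) m
      e′ m = trans (coeff-tailₚ p m) (trans (e (suc m)) (sym (coeff-tailₚ p′ m)))

  *ₚ-congˡ : ∀ p {r r′} → r ≋ r′ → (p *ₚ r) ≋ (p *ₚ r′)
  *ₚ-congˡ []      e = ≋-refl
  *ₚ-congˡ (a ∷ p) e = +ₚ-cong (·-congˡ a e) (shift-cong (*ₚ-congˡ p e))

  *ₚ-cong : ∀ {p p′ r r′} → p ≋ p′ → r ≋ r′ → (p *ₚ r) ≋ (p′ *ₚ r′)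
  *ₚ-cong {p′ = p′} {r} e f = ≋-trans (*ₚ-congʳ r e) (*ₚ-congˡ p′ f)

  *ₚ-zeroʳ : ∀ p → (p *ₚ []) ≋ []
  *ₚ-zeroʳ []      = ≋-refl
  *ₚ-zeroʳ (a ∷ p) = ≋-trans (shift-cong (*ₚ-zeroʳ p)) shift-[]

  *ₚ-· : ∀ c p r → (p *ₚ (c · r)) ≋ (c · (p *ₚ r))
  *ₚ-· c []      r = ≋-refl
  *ₚ-· c (a ∷ p) r = begin
    (a · (c · r)) +ₚ shift (p *ₚ (c · r))  ≈⟨ +ₚ-cong swap (shift-cong (*ₚ-· c p r)) ⟩
    (c · (a · r)) +ₚ shift (c · (p *ₚ r))  ≈⟨ +ₚ-cong ≋-refl (·-shift c (p *ₚ r)) ⟨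
    (c · (a · r)) +ₚ (c · shift (p *ₚ r))  ≈⟨ ·-distribˡ-+ₚ c (a · r) (shift (p *ₚ r)) ⟨
    c · ((a ∷ p) *ₚ r)                     ∎
    where
    open ≋-Reasoning
    swap : (a · (c · r)) ≋ (c · (a · r))
    swap = ≋-trans (≋-sym (·-assoc a c r)) (≋-trans (·-congʳ r (*-comm a c)) (·-assoc c a r))

  *ₚ-shift : ∀ p r → (p *ₚ shift r) ≋ shift (p *ₚ r)
  *ₚ-shift []      r = ≋-sym shift-[]
  *ₚ-shift (a ∷ p) r = begin
    (a · shift r) +ₚ shift (p *ₚ shift r)  ≈⟨ +ₚ-cong (·-shift a r) (shift-cong (*ₚ-shift p r)) ⟩
    shift (a · r) +ₚ shift (shift (p *ₚ r)) ≈⟨ shift-+ₚ (a · r) (shift (p *ₚ r)) ⟨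
    shift ((a ∷ p) *ₚ r)                    ∎
    where open ≋-Reasoning

  *ₚ-distribˡ-+ₚ : ∀ p r s → (p *ₚ (r +ₚ s)) ≋ ((p *ₚ r) +ₚ (p *ₚ s))
  *ₚ-distribˡ-+ₚ []      r s = ≋-refl
  *ₚ-distribˡ-+ₚ (a ∷ p) r s = begin
    (a · (r +ₚ s)) +ₚ shift (p *ₚ (r +ₚ s))
      ≈⟨ +ₚ-cong (·-distribˡ-+ₚ a r s)
                 (≋-trans (shift-cong (*ₚ-distribˡ-+ₚ p r s)) (shift-+ₚ (p *ₚ r) (p *ₚ s))) ⟩
    ((a · r) +ₚ (a · s)) +ₚ (shift (p *ₚ r) +ₚ shift (p *ₚ s))
      ≈⟨ +ₚ-interchange (a · r) (a · s) (shift (p *ₚ r)) (shift (p *ₚ s)) ⟩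
    ((a ∷ p) *ₚ r) +ₚ ((a ∷ p) *ₚ s) ∎
    where open ≋-Reasoning

  *ₚ-distribʳ-+ₚ : ∀ p r s → ((p +ₚ r) *ₚ s) ≋ ((p *ₚ s) +ₚ (r *ₚ s))
  *ₚ-distribʳ-+ₚ []      r       s = ≋-refl
  *ₚ-distribʳ-+ₚ (a ∷ p) []      s = ≋-sym (+ₚ-identityʳ _)
  *ₚ-distribʳ-+ₚ (a ∷ p) (b ∷ r) s = begin
    ((a + b) · s) +ₚ shift ((p +ₚ r) *ₚ s)
      ≈⟨ +ₚ-cong (·-distribʳ-+ a b s)
                 (≋-trans (shift-cong (*ₚ-distribʳ-+ₚ p r s)) (shift-+ₚ (p *ₚ s) (r *ₚ s))) ⟩
    ((a · s) +ₚ (b · s)) +ₚ (shift (p *ₚ s) +ₚ shift (r *ₚ s))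
      ≈⟨ +ₚ-interchange (a · s) (b · s) (shift (p *ₚ s)) (shift (r *ₚ s)) ⟩
    ((a ∷ p) *ₚ s) +ₚ ((b ∷ r) *ₚ s) ∎
    where open ≋-Reasoning

  *ₚ-const : ∀ r c → (r *ₚ const c) ≋ (c · r)
  *ₚ-const []      c = ≋-refl
  *ₚ-const (b ∷ r) c = ∷-cong (trans (+-identityʳ _) (*-comm b c)) (*ₚ-const r c)

  ∷≋const+shift : ∀ a p → (a ∷ p) ≋ (const a +ₚ shift p)
  ∷≋const+shift a p = ∷-cong (sym (+-identityʳ a)) ≋-refl

  *ₚ-comm : ∀ p r → (p *ₚ r) ≋ (r *ₚ p)
  *ₚ-comm []      r = ≋-sym (*ₚ-zeroʳ r)
  *ₚ-comm (a ∷ p) r = begin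
    (a · r) +ₚ shift (p *ₚ r)      ≈⟨ +ₚ-cong (≋-sym (*ₚ-const r a))
                                      (≋-trans (shift-cong (*ₚ-comm p r)) (≋-sym (*ₚ-shift r p))) ⟩
    (r *ₚ const a) +ₚ (r *ₚ shift p) ≈⟨ *ₚ-distribˡ-+ₚ r (const a) (shift p) ⟨
    r *ₚ (const a +ₚ shift p)      ≈⟨ *ₚ-congˡ r (∷≋const+shift a p) ⟨
    r *ₚ (a ∷ p)                   ∎
    where open ≋-Reasoning

  ·-*ₚ : ∀ c p r → ((c · p) *ₚ r) ≋ (c · (p *ₚ r))
  ·-*ₚ c p r = ≋-trans (*ₚ-comm (c · p) r) (≋-trans (*ₚ-· c r p) (·-congˡ c (*ₚ-comm r p)))

  shift-*ₚ : ∀ p r → (shift p *ₚ r) ≋ shift (p *ₚ r)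
  shift-*ₚ p r = +ₚ-cong (·-zeroˡ r) ≋-refl

  *ₚ-assoc : ∀ p r s → ((p *ₚ r) *ₚ s) ≋ (p *ₚ (r *ₚ s))
  *ₚ-assoc []      r s = ≋-refl
  *ₚ-assoc (a ∷ p) r s = begin
    ((a · r) +ₚ shift (p *ₚ r)) *ₚ s          ≈⟨ *ₚ-distribʳ-+ₚ (a · r) (shift (p *ₚ r)) s ⟩
    ((a · r) *ₚ s) +ₚ (shift (p *ₚ r) *ₚ s)   ≈⟨ +ₚ-cong (·-*ₚ a r s)
                                                 (≋-trans (shift-*ₚ (p *ₚ r) s) (shift-cong (*ₚ-assoc p r s))) ⟩
    (a · (r *ₚ s)) +ₚ shift (p *ₚ (r *ₚ s))   ∎
    where open ≋-Reasoning

  *ₚ-identityˡ : ∀ p → (const 1# *ₚ p) ≋ p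
  *ₚ-identityˡ p = ≋-trans (+ₚ-cong (·-identityˡ p) shift-[]) (+ₚ-identityʳ p)

  *ₚ-identityʳ : ∀ p → (p *ₚ const 1#) ≋ p
  *ₚ-identityʳ p = ≋-trans (*ₚ-comm p (const 1#)) (*ₚ-identityˡ p)

  commutativeRing : CommutativeRing 0ℓ 0ℓ
  commutativeRing = record
    { Carrier = Pol ; _≈_ = _≋_ ; _+_ = _+ₚ_ ; _*_ = _*ₚ_ ; -_ = -ₚ_ ; 0# = [] ; 1# = const 1#
    ; isCommutativeRing = record
      { isRing = record
        { +-isAbelianGroup = record
          { isGroup = record
            { isMonoid = record
              { isSemigroup = record
                { isMagma = record { isEquivalence = ≋-isEquivalence ; ∙-cong = +ₚ-cong }
                ; assoc = +ₚ-assoc }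
              ; identity = (λ _ → ≋-refl) , +ₚ-identityʳ }
            ; inverse = -ₚ-inverseˡ , -ₚ-inverseʳ
            ; ⁻¹-cong = -ₚ-cong }
          ; comm = +ₚ-comm }
        ; *-cong = *ₚ-cong
        ; *-assoc = *ₚ-assoc
        ; *-identity = *ₚ-identityˡ , *ₚ-identityʳ
        ; distrib = *ₚ-distribˡ-+ₚ , λ x y z → *ₚ-distribʳ-+ₚ y z x }
      ; *-comm = *ₚ-comm } }

  open import Algebra.Properties.CommutativeSemigroup.Divisibility
    (CommutativeRing.*-commutativeSemigroup commutativeRing)
    using (_∣_; _,_; ∣ʳ-respʳ-≈; ∣ʳ-respˡ-≈; x∣ʳy⇒x∣ʳzy) public
  open import Algebra.Properties.Ring (CommutativeRing.ring commutativeRing) using ([y-z]x≈yx-zx)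

  ∣ₚ⇒∣ : ∀ {g a} → g ∣ₚ a → g ∣ a
  ∣ₚ⇒∣ {g} (h , a≈gh) = h , ≋-trans (*ₚ-comm h g) (≋-sym (mk≋ a≈gh))

  ∣-refl : ∀ {g} → g ∣ g
  ∣-refl {g} = const 1# , *ₚ-identityˡ g

  ∣-*ʳ : ∀ {g a} b → g ∣ a → g ∣ (a *ₚ b)
  ∣-*ʳ {a = a} b g∣a = ∣ʳ-respʳ-≈ (*ₚ-comm b a) (x∣ʳy⇒x∣ʳzy b g∣a)

  x∣y∧x∣z⇒x∣y-z : ∀ {g a b} → g ∣ a → g ∣ b → g ∣ (a -ₚ b)
  x∣y∧x∣z⇒x∣y-z {g} (h , hg≈a) (k , kg≈b) =
    (h -ₚ k) , ≋-trans ([y-z]x≈yx-zx g h k) (+ₚ-cong hg≈a (-ₚ-cong kg≈b))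

  ^ₚ-cong : ∀ {p r} n → p ≋ r → (p ^ₚ n) ≋ (r ^ₚ n)
  ^ₚ-cong zero    e = ≋-refl
  ^ₚ-cong (suc n) e = *ₚ-cong e (^ₚ-cong n e)

module Exponentiation (R : CommutativeRing 0ℓ 0ℓ) where
  open CommutativeRing R
  open Poly R using (_^ᵣ_)
  open import Algebra.Properties.Semiring.Exp semiring using (_^_)

  ^ᵣ≈^ : ∀ x n → x ^ᵣ n ≈ x ^ n
  ^ᵣ≈^ x zero    = refl
  ^ᵣ≈^ x (suc n) = *-congˡ (^ᵣ≈^ x n)

  1#^n≈1# : ∀ n → 1# ^ n ≈ 1#
  1#^n≈1# zero    = refl
  1#^n≈1# (suc n) = trans (*-identityˡ _) (1#^n≈1# n)

-- The ring solver with integer coefficients, mapped into R by n ↦ n × 1#: normal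
-- forms must be compared by computation, which R's own equality does not allow.
module IntegerCoefficientSolver (R : CommutativeRing 0ℓ 0ℓ) where
  open CommutativeRing R
  open import Algebra.Solver.Ring.AlmostCommutativeRing
  open import Algebra.Properties.Semiring.Mult semiring using (_×_; ×-homo-+)
  open import Algebra.Properties.Ring ring using (-0#≈0#; -‿involutive; -‿distribˡ-*; -‿+-comm)
  open import Algebra.Properties.CommutativeSemigroup +-commutativeSemigroup using (interchange)
  open Relation.Binary.Reasoning.Setoid setoid

  ⟦_⟧ℤ : ℤ → Carrier
  ⟦ + n      ⟧ℤ = n × 1#
  ⟦ -[1+ n ] ⟧ℤ = - (suc n × 1#)

  ⟦-⟧ℤ : ∀ i → ⟦ ℤ.- i ⟧ℤ ≈ - ⟦ i ⟧ℤ
  ⟦-⟧ℤ (+ zero)  = sym -0#≈0#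
  ⟦-⟧ℤ (+ suc n) = refl
  ⟦-⟧ℤ -[1+ n ]  = sym (-‿involutive _)

  ⟦⊖⟧ℤ : ∀ m n → ⟦ m ⊖ n ⟧ℤ ≈ m × 1# - n × 1#
  ⟦⊖⟧ℤ m       zero    = trans (sym (+-identityʳ _)) (+-congˡ (sym -0#≈0#))
  ⟦⊖⟧ℤ zero    (suc n) = sym (+-identityˡ _)
  ⟦⊖⟧ℤ (suc m) (suc n) = begin
    ⟦ suc m ⊖ suc n ⟧ℤ                   ≡⟨ ≡.cong ⟦_⟧ℤ (ℤ.[1+m]⊖[1+n]≡m⊖n m n) ⟩
    ⟦ m ⊖ n ⟧ℤ                           ≈⟨ ⟦⊖⟧ℤ m n ⟩
    m × 1# - n × 1#                      ≈⟨ +-identityˡ _ ⟨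
    0# + (m × 1# - n × 1#)               ≈⟨ +-congʳ (-‿inverseʳ 1#) ⟨
    (1# - 1#) + (m × 1# - n × 1#)        ≈⟨ interchange _ _ _ _ ⟩
    (1# + m × 1#) + (- 1# - n × 1#)      ≈⟨ +-congˡ (-‿+-comm 1# (n × 1#)) ⟩
    (1# + m × 1#) - (1# + n × 1#)        ∎

  ⟦+⟧ℤ : ∀ i j → ⟦ i ℤ.+ j ⟧ℤ ≈ ⟦ i ⟧ℤ + ⟦ j ⟧ℤ
  ⟦+⟧ℤ (+ m)    (+ n)    = ×-homo-+ 1# m n
  ⟦+⟧ℤ (+ m)    -[1+ n ] = ⟦⊖⟧ℤ m (suc n)
  ⟦+⟧ℤ -[1+ m ] (+ n)    = trans (⟦⊖⟧ℤ n (suc m)) (+-comm _ _)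
  ⟦+⟧ℤ -[1+ m ] -[1+ n ] = begin
    - (suc (suc (m ℕ.+ n)) × 1#)       ≡⟨ ≡.cong (λ k → - (suc k × 1#)) (≡.sym (ℕ.+-suc m n)) ⟩
    - ((suc m ℕ.+ suc n) × 1#)         ≈⟨ -‿cong (×-homo-+ 1# (suc m) (suc n)) ⟩
    - (suc m × 1# + suc n × 1#)        ≈⟨ -‿+-comm _ _ ⟨
    - (suc m × 1#) + - (suc n × 1#)    ∎

  ⟦+*⟧ℤ : ∀ m j → ⟦ + m ℤ.* j ⟧ℤ ≈ (m × 1#) * ⟦ j ⟧ℤ
  ⟦+*⟧ℤ zero    j = begin
    ⟦ + 0 ℤ.* j ⟧ℤ   ≡⟨ ≡.cong ⟦_⟧ℤ (ℤ.*-zeroˡ j) ⟩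
    0#               ≈⟨ zeroˡ _ ⟨
    0# * ⟦ j ⟧ℤ      ∎
  ⟦+*⟧ℤ (suc m) j = begin
    ⟦ + suc m ℤ.* j ⟧ℤ                     ≡⟨ ≡.cong ⟦_⟧ℤ (ℤ.suc-* (+ m) j) ⟩
    ⟦ j ℤ.+ + m ℤ.* j ⟧ℤ                   ≈⟨ ⟦+⟧ℤ j (+ m ℤ.* j) ⟩
    ⟦ j ⟧ℤ + ⟦ + m ℤ.* j ⟧ℤ                ≈⟨ +-cong (sym (*-identityˡ _)) (⟦+*⟧ℤ m j) ⟩
    1# * ⟦ j ⟧ℤ + (m × 1#) * ⟦ j ⟧ℤ        ≈⟨ distribʳ _ _ _ ⟨
    (1# + m × 1#) * ⟦ j ⟧ℤ                 ∎

  ⟦*⟧ℤ : ∀ i j → ⟦ i ℤ.* j ⟧ℤ ≈ ⟦ i ⟧ℤ * ⟦ j ⟧ℤ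
  ⟦*⟧ℤ (+ m)    j = ⟦+*⟧ℤ m j
  ⟦*⟧ℤ -[1+ m ] j = begin
    ⟦ -[1+ m ] ℤ.* j ⟧ℤ            ≡⟨ ≡.cong ⟦_⟧ℤ (≡.sym (ℤ.neg-distribˡ-* (+ suc m) j)) ⟩
    ⟦ ℤ.- (+ suc m ℤ.* j) ⟧ℤ        ≈⟨ ⟦-⟧ℤ (+ suc m ℤ.* j) ⟩
    - ⟦ + suc m ℤ.* j ⟧ℤ            ≈⟨ -‿cong (⟦+*⟧ℤ (suc m) j) ⟩
    - ((suc m × 1#) * ⟦ j ⟧ℤ)       ≈⟨ -‿distribˡ-* _ _ ⟩
    - (suc m × 1#) * ⟦ j ⟧ℤ         ∎

  ℤ⟶R : ℤ.+-*-rawRing -Raw-AlmostCommutative⟶ fromCommutativeRing R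
  ℤ⟶R = record
    { ⟦_⟧ = ⟦_⟧ℤ ; +-homo = ⟦+⟧ℤ ; *-homo = ⟦*⟧ℤ ; -‿homo = ⟦-⟧ℤ
    ; 0-homo = refl ; 1-homo = +-identityʳ 1# }

  ⟦⟧ℤ-≟ : WeaklyDecidable (λ i j → ⟦ i ⟧ℤ ≈ ⟦ j ⟧ℤ)
  ⟦⟧ℤ-≟ i j with i ℤ.≟ j
  ... | yes ≡.refl = just refl
  ... | no _       = nothing

  open import Algebra.Solver.Ring ℤ.+-*-rawRing (fromCommutativeRing R) ℤ⟶R ⟦⟧ℤ-≟ public

record DecidableField : Set₁ where
  field
    cring : CommutativeRing 0ℓ 0ℓ
  open CommutativeRing cring public
  infix 4 _≟_
  field
    0≉1     : ¬ (0# ≈ 1#)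
    inverse : ∀ x → ¬ (x ≈ 0#) → Σ Carrier λ y → x * y ≈ 1#
    _≟_     : Decidable _≈_

  1≉0 : ¬ (1# ≈ 0#)
  1≉0 e = 0≉1 (sym e)

  x≉0∧y≉0⇒x*y≉0 : ∀ {x y} → ¬ (x ≈ 0#) → ¬ (y ≈ 0#) → ¬ (x * y ≈ 0#)
  x≉0∧y≉0⇒x*y≉0 {x} {y} x≉0 y≉0 xy≈0 = y≉0 (begin
    y              ≈⟨ *-identityˡ y ⟨
    1# * y         ≈⟨ *-congʳ (trans (sym xx⁻¹) (*-comm x x⁻¹)) ⟩
    (x⁻¹ * x) * y  ≈⟨ *-assoc x⁻¹ x y ⟩
    x⁻¹ * (x * y)  ≈⟨ *-congˡ xy≈0 ⟩
    x⁻¹ * 0#       ≈⟨ zeroʳ x⁻¹ ⟩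
    0#             ∎)
    where
    open Relation.Binary.Reasoning.Setoid setoid
    x⁻¹ = proj₁ (inverse x x≉0)
    xx⁻¹ = proj₂ (inverse x x≉0)

  x≉0∧x*x≈x⇒x≈1 : ∀ {x} → ¬ (x ≈ 0#) → x * x ≈ x → x ≈ 1#
  x≉0∧x*x≈x⇒x≈1 {x} x≉0 xx≈x = begin
    x               ≈⟨ *-identityʳ x ⟨
    x * 1#          ≈⟨ *-congˡ xx⁻¹ ⟨
    x * (x * x⁻¹)   ≈⟨ *-assoc x x x⁻¹ ⟨
    (x * x) * x⁻¹   ≈⟨ *-congʳ xx≈x ⟩
    x * x⁻¹         ≈⟨ xx⁻¹ ⟩
    1#              ∎
    where
    open Relation.Binary.Reasoning.Setoid setoid
    x⁻¹ = proj₁ (inverse x x≉0)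
    xx⁻¹ = proj₂ (inverse x x≉0)

module PolynomialsOverField (K : DecidableField) where
  open import Data.Product using (_×_)
  open DecidableField K
  open PolynomialRing cring public
  open IntegerCoefficientSolver commutativeRing using (solve; _:=_; _:+_; _:-_; _:*_)
  open import Algebra.Properties.Ring (CommutativeRing.ring commutativeRing)
    using (x∙y⁻¹≈ε⇒x≈y; x≈y⇒x∙y⁻¹≈ε; x[y-z]≈xy-xz)
  open import Algebra.Properties.Ring ring using () renaming (x∙y⁻¹≈ε⇒x≈y to x-y≈0⇒x≈y)

  record Deg< (d : ℕ) (p : Pol) : Set where
    constructor mkDeg<
    field vanishes : ∀ n → d ≤ n → coeff p n ≈ 0#
  open Deg< public

  record HasDegree (d : ℕ) (p : Pol) : Set where
    constructor mkHasDegree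
    field
      leading≉0 : ¬ (coeff p d ≈ 0#)
      deg<      : Deg< (suc d) p
  open HasDegree public

  Deg<-mono : ∀ {d e p} → d ≤ e → Deg< d p → Deg< e p
  Deg<-mono d≤e s = mkDeg< λ n e≤n → vanishes s n (ℕ.≤-trans d≤e e≤n)

  Deg<-length : ∀ p → Deg< (length p) p
  Deg<-length []      = mkDeg< λ _ _ → refl
  Deg<-length (a ∷ p) = mkDeg< λ { (suc n) (s≤s le) → vanishes (Deg<-length p) n le }

  Deg<0⇒≋[] : ∀ {p} → Deg< 0 p → p ≋ []
  Deg<0⇒≋[] s = mk≋ λ n → vanishes s n z≤n

  Deg<-tailₚ : ∀ {d p} → Deg< (suc d) p → Deg< d (tailₚ p)
  Deg<-tailₚ {p = p} s = mkDeg< λ n le → trans (coeff-tailₚ p n) (vanishes s (suc n) (s≤s le))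

  HasDegree-unique : ∀ {d e p} → HasDegree d p → HasDegree e p → d ≡ e
  HasDegree-unique {d} {e} hd he with ℕ.<-cmp d e
  ... | tri< d<e _ _ = ⊥-elim (leading≉0 he (vanishes (deg< hd) e d<e))
  ... | tri≈ _ d≡e _ = d≡e
  ... | tri> _ _ e<d = ⊥-elim (leading≉0 hd (vanishes (deg< he) d e<d))

  HasDegree-cong : ∀ {d p r} → p ≋ r → HasDegree d p → HasDegree d r
  HasDegree-cong p≈r (mkHasDegree nz s) = mkHasDegree (λ z → nz (trans (at p≈r _) z))
    (mkDeg< λ n le → trans (sym (at p≈r n)) (vanishes s n le))

  Deg<∧HasDegree⇒≤ : ∀ {d e g} → Deg< (suc d) g → HasDegree e g → e ≤ d
  Deg<∧HasDegree⇒≤ {d} {e} s he with e ℕ.≤? d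
  ... | yes e≤d = e≤d
  ... | no  e≰d = ⊥-elim (leading≉0 he (vanishes s e (ℕ.≰⇒> e≰d)))

  Monic⇒HasDegree : ∀ {d} p → MonicOfDeg d p → HasDegree d p
  Monic⇒HasDegree p (c≈1 , above) = mkHasDegree (λ c≈0 → 1≉0 (trans (sym c≈1) c≈0)) (mkDeg< above)

  Monic⇒≉[] : ∀ {d} p → MonicOfDeg d p → ¬ (p ≋ [])
  Monic⇒≉[] p (c≈1 , _) p≈0 = 1≉0 (trans (sym c≈1) (at p≈0 _))

  ∷-≋[] : ∀ {a p} → a ≈ 0# → p ≋ [] → (a ∷ p) ≋ []
  ∷-≋[] a≈0 p≈0 = mk≋ λ { zero → a≈0 ; (suc n) → at p≈0 n }

  ≋[]? : ∀ p → Dec (p ≋ [])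
  ≋[]? []      = yes ≋-refl
  ≋[]? (a ∷ p) with a ≟ 0# | ≋[]? p
  ... | yes a≈0 | yes p≈0 = yes (∷-≋[] a≈0 p≈0)
  ... | no  a≉0 | _       = no λ e → a≉0 (at e 0)
  ... | yes _   | no  p≉0 = no λ e → p≉0 (mk≋ λ n → at e (suc n))

  _≋?_ : ∀ p r → Dec (p ≋ r)
  p ≋? r with ≋[]? (p -ₚ r)
  ... | yes p-r≈0 = yes (x∙y⁻¹≈ε⇒x≈y p r p-r≈0)
  ... | no  p-r≉0 = no λ p≈r → p-r≉0 (x≈y⇒x∙y⁻¹≈ε p≈r)

  ≉[]⇒HasDegree : ∀ p → ¬ (p ≋ []) → Σ ℕ λ d → HasDegree d p
  ≉[]⇒HasDegree []      p≉0 = ⊥-elim (p≉0 ≋-refl)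
  ≉[]⇒HasDegree (a ∷ p) a∷p≉0 with ≋[]? p
  ... | yes p≈0 = 0 , mkHasDegree (λ a≈0 → a∷p≉0 (∷-≋[] a≈0 p≈0)) (mkDeg< λ { (suc n) _ → at p≈0 n })
  ... | no  p≉0 with ≉[]⇒HasDegree p p≉0
  ...   | d , mkHasDegree nz s = suc d , mkHasDegree nz (mkDeg< λ { (suc n) (s≤s le) → vanishes s n le })

  Deg<1⇒coeff-*ₚ : ∀ {p} r → Deg< 1 p → ∀ n → coeff (p *ₚ r) n ≈ coeff p 0 * coeff r n
  Deg<1⇒coeff-*ₚ {p} r s zero    = coeff-*ₚ-zero p r
  Deg<1⇒coeff-*ₚ {p} r s (suc n) = trans (coeff-*ₚ-suc p r n)
    (trans (+-congˡ (at (*ₚ-congʳ r (Deg<0⇒≋[] (Deg<-tailₚ s))) n)) (+-identityʳ _))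

  *ₚ-Deg< : ∀ {d e p r} → Deg< (suc d) p → Deg< (suc e) r →
    Deg< (suc (d ℕ.+ e)) (p *ₚ r) × (coeff (p *ₚ r) (d ℕ.+ e) ≈ coeff p d * coeff r e)
  *ₚ-Deg< {zero} {e} {p} {r} sp sr =
    mkDeg< (λ n le → trans (Deg<1⇒coeff-*ₚ r sp n) (trans (*-congˡ (vanishes sr n le)) (zeroʳ _))) ,
    Deg<1⇒coeff-*ₚ r sp e
  *ₚ-Deg< {suc d} {e} {p} {r} sp sr = mkDeg< bound , top
    where
    ih = *ₚ-Deg< (Deg<-tailₚ sp) sr
    r-vanishes : ∀ m → e < m → coeff p 0 * coeff r m ≈ 0#
    r-vanishes m e<m = trans (*-congˡ (vanishes sr m e<m)) (zeroʳ _)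
    bound : ∀ n → suc (suc d ℕ.+ e) ≤ n → coeff (p *ₚ r) n ≈ 0#
    bound (suc m) (s≤s le) = trans (coeff-*ₚ-suc p r m) (trans
      (+-cong (r-vanishes (suc m) (s≤s (ℕ.≤-trans (ℕ.m≤n+m e d) (ℕ.≤-trans (ℕ.n≤1+n _) le))))
              (vanishes (proj₁ ih) m le))
      (+-identityˡ 0#))
    top : coeff (p *ₚ r) (suc d ℕ.+ e) ≈ coeff p (suc d) * coeff r e
    top = trans (coeff-*ₚ-suc p r (d ℕ.+ e)) (trans
      (+-cong (r-vanishes (suc (d ℕ.+ e)) (s≤s (ℕ.m≤n+m e d))) (proj₂ ih))
      (trans (+-identityˡ _) (*-congʳ (coeff-tailₚ p d))))

  HasDegree-· : ∀ {d c p} → ¬ (c ≈ 0#) → HasDegree d p → HasDegree d (c · p)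
  HasDegree-· {c = c} {p} c≉0 (mkHasDegree nz s) = mkHasDegree
    (λ z → x≉0∧y≉0⇒x*y≉0 c≉0 nz (trans (sym (coeff-· c p _)) z))
    (mkDeg< λ n le → trans (coeff-· c p n) (trans (*-congˡ (vanishes s n le)) (zeroʳ c)))

  HasDegree-*ₚ : ∀ {d e p r} → HasDegree d p → HasDegree e r → HasDegree (d ℕ.+ e) (p *ₚ r)
  HasDegree-*ₚ (mkHasDegree nzp sp) (mkHasDegree nzr sr) = mkHasDegree
    (λ z → x≉0∧y≉0⇒x*y≉0 nzp nzr (trans (sym (proj₂ prod)) z)) (proj₁ prod)
    where prod = *ₚ-Deg< sp sr

  *ₚ-≉[] : ∀ {p r} → ¬ (p ≋ []) → ¬ (r ≋ []) → ¬ ((p *ₚ r) ≋ [])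
  *ₚ-≉[] {p} {r} p≉0 r≉0 pr≈0 with ≉[]⇒HasDegree p p≉0 | ≉[]⇒HasDegree r r≉0
  ... | d , dp | e , dr = leading≉0 (HasDegree-*ₚ dp dr) (at pr≈0 (d ℕ.+ e))

  *ₚ-cancelˡ : ∀ {p a b} → ¬ (p ≋ []) → (p *ₚ a) ≋ (p *ₚ b) → a ≋ b
  *ₚ-cancelˡ {p} {a} {b} p≉0 pa≈pb with a ≋? b
  ... | yes a≈b = a≈b
  ... | no  a≉b = ⊥-elim (*ₚ-≉[] p≉0 (λ a-b≈0 → a≉b (x∙y⁻¹≈ε⇒x≈y a b a-b≈0))
                    (≋-trans (x[y-z]≈xy-xz p a b) (x≈y⇒x∙y⁻¹≈ε pa≈pb)))

  const-cong : ∀ {a b} → a ≈ b → const a ≋ const b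
  const-cong e = ∷-cong e ≋-refl

  const-0# : const 0# ≋ []
  const-0# = ∷-≋[] refl ≋-refl

  const-*ₚ : ∀ a b → (const a *ₚ const b) ≋ const (a * b)
  const-*ₚ a b = ∷-cong (+-identityʳ _) ≋-refl

  IsConstant⇒≋const : ∀ p → IsConstant p → p ≋ const (coeff p 0)
  IsConstant⇒≋const p c = mk≋ λ { zero → refl ; (suc n) → c (suc n) (s≤s z≤n) }

  record DivMod (f g : Pol) (d : ℕ) : Set where
    constructor mkDivMod
    field
      quot rem : Pol
      equation : f ≋ ((quot *ₚ g) +ₚ rem)
      rem-deg< : Deg< d rem

  -- Long division by g of degree d, one coefficient of f at a time: from
  -- f = Q′ g + R′ we get a ∷ f = (0 ∷ Q′) g + (a ∷ R′), and the coefficient k of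
  -- T^d in a ∷ R′ is cancelled by moving (k / lc g) · g into the quotient.
  divMod : ∀ {d g} → HasDegree d g → ∀ f → DivMod f g d
  divMod hd []      = mkDivMod [] [] ≋-refl (mkDeg< λ _ _ → refl)
  divMod {d} {g} hd (a ∷ f) with divMod hd f | inverse (coeff g d) (leading≉0 hd)
  ... | mkDivMod Q′ R′ e′ s′ | c⁻¹ , cc⁻¹ = mkDivMod (t ∷ Q′) R equation (mkDeg< degree)
    where
    R″ = a ∷ R′
    k = coeff R″ d
    t = k * c⁻¹
    R = R″ -ₚ (t · g)
    equation : (a ∷ f) ≋ (((t ∷ Q′) *ₚ g) +ₚ R)
    equation = ≋-sym (≋-trans
      (solve 3 (λ A B C → ((A :+ B) :+ (C :- A)) := (B :+ C)) ≋-refl (t · g) (shift (Q′ *ₚ g)) R″)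
      (∷-cong (+-identityˡ a) (≋-sym e′)))
    coeff-R : ∀ n → coeff R n ≈ coeff R″ n - t * coeff g n
    coeff-R n = trans (coeff-+ₚ R″ (-ₚ (t · g)) n)
      (+-congˡ (trans (coeff-negₚ (t · g) n) (-‿cong (coeff-· t g n))))
    t*c≈k : t * coeff g d ≈ k
    t*c≈k = trans (*-assoc k c⁻¹ _) (trans (*-congˡ (trans (*-comm c⁻¹ _) cc⁻¹)) (*-identityʳ k))
    degree : ∀ n → d ≤ n → coeff R n ≈ 0#
    degree n d≤n with n ℕ.≟ d
    ... | yes ≡.refl = trans (coeff-R n) (trans (+-congˡ (-‿cong t*c≈k)) (-‿inverseʳ k))
    degree zero    d≤n | no n≢d = ⊥-elim (n≢d (≡.sym (ℕ.n≤0⇒n≡0 d≤n)))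
    degree (suc m) d≤n | no n≢d = trans (coeff-R (suc m)) (trans
      (+-cong (vanishes s′ m (ℕ.≤-pred d<n)) (-‿cong (trans (*-congˡ (vanishes (deg< hd) (suc m) d<n)) (zeroʳ t))))
      (-‿inverseʳ 0#))
      where d<n = ℕ.≤∧≢⇒< d≤n (λ z → n≢d (≡.sym z))

  record Bezout (f g : Pol) : Set where
    constructor mkBezout
    field
      h u v f/h g/h : Pol
      combination : ((u *ₚ f) +ₚ (v *ₚ g)) ≋ h
      f≋h*f/h : f ≋ (h *ₚ f/h)
      g≋h*g/h : g ≋ (h *ₚ g/h)

  bezout-[] : ∀ f g → g ≋ [] → Bezout f g
  bezout-[] f g g≈0 = mkBezout f (const 1#) [] (const 1#) []
    (≋-trans (+ₚ-identityʳ _) (*ₚ-identityˡ f)) (≋-sym (*ₚ-identityʳ f)) (≋-trans g≈0 (≋-sym (*ₚ-zeroʳ f)))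

  -- Euclid's algorithm; d bounds the degree of g and decreases at each step.
  bezout : ∀ d f g → Deg< d g → Bezout f g
  bezout zero    f g s = bezout-[] f g (Deg<0⇒≋[] s)
  bezout (suc d) f g s with ≋[]? g
  ... | yes g≈0 = bezout-[] f g g≈0
  ... | no  g≉0 with ≉[]⇒HasDegree g g≉0
  ... | e , hd with divMod hd f
  ... | mkDivMod Q R f≈Qg+R sR with bezout d g R (Deg<-mono (Deg<∧HasDegree⇒≤ s hd) sR)
  ... | mkBezout h u v g/h R/h comb g≈ R≈ =
    mkBezout h v (u -ₚ (v *ₚ Q)) ((Q *ₚ g/h) +ₚ R/h) g/h combination f≈ g≈
    where
    combination : ((v *ₚ f) +ₚ ((u -ₚ (v *ₚ Q)) *ₚ g)) ≋ h
    combination = ≋-trans (+ₚ-cong (*ₚ-congˡ v f≈Qg+R) ≋-refl) (≋-trans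
      (solve 5 (λ v u Q g R → ((v :* ((Q :* g) :+ R)) :+ ((u :- (v :* Q)) :* g)) := ((u :* g) :+ (v :* R)))
        ≋-refl v u Q g R)
      comb)
    f≈ : f ≋ (h *ₚ ((Q *ₚ g/h) +ₚ R/h))
    f≈ = ≋-trans f≈Qg+R (≋-trans (+ₚ-cong (*ₚ-congˡ Q g≈) R≈)
      (solve 4 (λ Q h s t → ((Q :* (h :* s)) :+ (h :* t)) := (h :* ((Q :* s) :+ t))) ≋-refl Q h g/h R/h))

  Monic∤Deg< : ∀ {d π R} → MonicOfDeg d π → Deg< d R → ¬ (R ≋ []) → ¬ (π ∣ R)
  Monic∤Deg< {d} {π} {R} m sR R≉0 (h , hπ≈R) with ≋[]? h
  ... | yes h≈0 = R≉0 (≋-trans (≋-sym hπ≈R)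
                      (≋-trans (*ₚ-comm h π) (≋-trans (*ₚ-congˡ π h≈0) (*ₚ-zeroʳ π))))
  ... | no  h≉0 with ≉[]⇒HasDegree h h≉0
  ... | k , hk = leading≉0 (HasDegree-*ₚ (Monic⇒HasDegree π m) hk)
      (trans (at (≋-trans (*ₚ-comm π h) hπ≈R) (d ℕ.+ k)) (vanishes sR (d ℕ.+ k) (ℕ.m≤m+n d k)))

  Monic∤const : ∀ {d π c} → 1 ≤ d → MonicOfDeg d π → ¬ (c ≈ 0#) → ¬ (π ∣ const c)
  Monic∤const {c = c} 1≤d m c≉0 = Monic∤Deg< m (Deg<-mono 1≤d const-Deg<1) (λ e → c≉0 (at e 0))
    where
    const-Deg<1 : Deg< 1 (const c)
    const-Deg<1 = mkDeg< λ { (suc n) _ → refl }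

  nonzeroConstant⇒unit : ∀ p → IsConstant p → ¬ (p ≋ []) → Σ Pol λ p⁻¹ → (p⁻¹ *ₚ p) ≋ const 1#
  nonzeroConstant⇒unit p p-const p≉0 with coeff p 0 ≟ 0#
  ... | yes p₀≈0 = ⊥-elim (p≉0 (≋-trans p≈p₀ (≋-trans (const-cong p₀≈0) const-0#)))
    where p≈p₀ = IsConstant⇒≋const p p-const
  ... | no  p₀≉0 with inverse (coeff p 0) p₀≉0
  ...   | c , p₀c≈1 = const c , ≋-trans (*ₚ-congˡ (const c) (IsConstant⇒≋const p p-const))
                                 (≋-trans (const-*ₚ c _) (const-cong (trans (*-comm c _) p₀c≈1)))

  -- The gcd h of π and a divides π, so h or π/h is a unit; in the second case
  -- π ∣ h ∣ a, and in the first, dividing the Bézout identity by h gives u π + v a = 1.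
  MonicIrreducible∤⇒bezout : ∀ {d π a} → MonicIrreducible d π → ¬ (π ∣ a) →
    Σ Pol λ u → Σ Pol λ v → ((u *ₚ π) +ₚ (v *ₚ a)) ≋ const 1#
  MonicIrreducible∤⇒bezout {d} {π} {a} (_ , m , irr) π∤a
    with bezout (length a) π a (Deg<-length a)
  ... | mkBezout h u v π/h a/h comb π≈ a≈ with irr h π/h (at π≈)
  ...   | inj₁ h-const with nonzeroConstant⇒unit h h-const
                               (λ h≈0 → Monic⇒≉[] π m (≋-trans π≈ (*ₚ-congʳ π/h h≈0)))
  ...     | h⁻¹ , h⁻¹h≈1 = (h⁻¹ *ₚ u) , (h⁻¹ *ₚ v) , ≋-trans
    (solve 5 (λ K U P V A → (((K :* U) :* P) :+ ((K :* V) :* A)) := (K :* ((U :* P) :+ (V :* A))))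
      ≋-refl h⁻¹ u π v a)
    (≋-trans (*ₚ-congˡ h⁻¹ comb) h⁻¹h≈1)
  MonicIrreducible∤⇒bezout {d} {π} {a} (_ , m , irr) π∤a
    | mkBezout h u v π/h a/h comb π≈ a≈ | inj₂ π/h-const
    with nonzeroConstant⇒unit π/h π/h-const
           (λ s≈0 → Monic⇒≉[] π m (≋-trans π≈ (≋-trans (*ₚ-congˡ h s≈0) (*ₚ-zeroʳ h))))
  ...     | s⁻¹ , s⁻¹s≈1 = ⊥-elim (π∤a (∣ʳ-respʳ-≈ (≋-sym a≈) (∣-*ʳ a/h (s⁻¹ , s⁻¹π≈h))))
    where
    s⁻¹π≈h : (s⁻¹ *ₚ π) ≋ h
    s⁻¹π≈h = ≋-trans (*ₚ-congˡ s⁻¹ π≈) (≋-trans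
      (solve 3 (λ S H P → (S :* (H :* P)) := (H :* (S :* P))) ≋-refl s⁻¹ h π/h)
      (≋-trans (*ₚ-congˡ h s⁻¹s≈1) (*ₚ-identityʳ h)))

  _∣?_ : ∀ {d} π → MonicOfDeg d π → ∀ a → Dec (π ∣ a)
  (π ∣? m) a with divMod (Monic⇒HasDegree π m) a
  ... | mkDivMod Q R a≈Qπ+R sR with ≋[]? R
  ... | yes R≈0 = yes (Q , ≋-sym (≋-trans a≈Qπ+R (≋-trans (+ₚ-cong ≋-refl R≈0) (+ₚ-identityʳ _))))
  ... | no  R≉0 = no λ π∣a →
    Monic∤Deg< m sR R≉0 (∣ʳ-respʳ-≈ a-Qπ≈R (x∣y∧x∣z⇒x∣y-z π∣a (x∣ʳy⇒x∣ʳzy Q ∣-refl)))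
    where
    a-Qπ≈R : (a -ₚ (Q *ₚ π)) ≋ R
    a-Qπ≈R = ≋-trans (+ₚ-cong a≈Qπ+R ≋-refl) (solve 2 (λ A R → ((A :+ R) :- A) := R) ≋-refl (Q *ₚ π) R)

  euclid : ∀ {d π a b} → MonicIrreducible d π → π ∣ (a *ₚ b) → π ∣ a ⊎ π ∣ b
  euclid {π = π} {a} {b} mi@(_ , m , _) (k , kπ≈ab) with (π ∣? m) a
  ... | yes π∣a = inj₁ π∣a
  ... | no  π∤a with MonicIrreducible∤⇒bezout mi π∤a
  ... | u , v , uπ+va≈1 = inj₂ ((u *ₚ b) +ₚ (v *ₚ k) , ≋-trans
    (solve 5 (λ U B V K P → (((U :* B) :+ (V :* K)) :* P) := (((U :* P) :* B) :+ (V :* (K :* P))))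
      ≋-refl u b v k π)
    (≋-trans (+ₚ-cong ≋-refl (*ₚ-congˡ v kπ≈ab))
    (≋-trans (solve 5 (λ U P B V A → (((U :* P) :* B) :+ (V :* (A :* B))) := (((U :* P) :+ (V :* A)) :* B))
      ≋-refl u π b v a)
    (≋-trans (*ₚ-congʳ b uπ+va≈1) (*ₚ-identityˡ b)))))

  MonicIrreducible-∣⇒≋ : ∀ {d d′ π π′} → MonicIrreducible d π → MonicIrreducible d′ π′ →
    π ∣ π′ → π ≋ π′
  MonicIrreducible-∣⇒≋ {d} {d′} {π} {π′} (1≤d , m , _) (_ , m′ , irr′) (h , hπ≈π′)
    with irr′ π h (at (≋-trans (≋-sym hπ≈π′) (*ₚ-comm h π)))
  ... | inj₁ π-const = ⊥-elim (1≉0 (trans (sym (proj₁ m)) (π-const d 1≤d)))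
  ... | inj₂ h-const = ≋-sym (≋-trans π′≈cπ (≋-trans (·-congʳ π c≈1) (·-identityˡ π)))
    where
    c = coeff h 0
    π′≈cπ : π′ ≋ (c · π)
    π′≈cπ = ≋-trans (≋-sym hπ≈π′) (≋-trans (*ₚ-congʳ π (IsConstant⇒≋const h h-const))
      (≋-trans (*ₚ-comm (const c) π) (*ₚ-const π c)))
    coeff-π′-d : coeff π′ d ≈ c
    coeff-π′-d = trans (at π′≈cπ d) (trans (coeff-· c π d) (trans (*-congˡ (proj₁ m)) (*-identityʳ c)))
    c≈1 : c ≈ 1#
    c≈1 with c ≟ 0#
    ... | yes c≈0 = ⊥-elim (Monic⇒≉[] π′ m′ (≋-trans π′≈cπ (≋-trans (·-congʳ π c≈0) (·-zeroˡ π))))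
    ... | no  c≉0 with HasDegree-unique (HasDegree-cong (≋-sym π′≈cπ) (HasDegree-· c≉0 (Monic⇒HasDegree π m)))
                                        (Monic⇒HasDegree π′ m′)
    ...   | ≡.refl = trans (sym coeff-π′-d) (proj₁ m′)

  residue-unique : ∀ {d π A ω ω′} → 1 ≤ d → MonicOfDeg d π →
    π ∣ (A -ₚ const ω) → π ∣ (A -ₚ const ω′) → ω ≈ ω′
  residue-unique {π = π} {A} {ω} {ω′} 1≤d m π∣A-ω π∣A-ω′ with (ω′ - ω) ≟ 0#
  ... | yes ω′-ω≈0 = sym (x-y≈0⇒x≈y ω′ ω ω′-ω≈0)
  ... | no  ω′-ω≉0 =
    ⊥-elim (Monic∤const 1≤d m ω′-ω≉0 (∣ʳ-respʳ-≈ difference (x∣y∧x∣z⇒x∣y-z π∣A-ω π∣A-ω′)))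
    where
    difference : ((A -ₚ const ω) -ₚ (A -ₚ const ω′)) ≋ const (ω′ - ω)
    difference = solve 3 (λ A W W′ → ((A :- W) :- (A :- W′)) := (W′ :- W)) ≋-refl A (const ω) (const ω′)

  MonicOfDeg-*ₚ : ∀ {d e p r} → MonicOfDeg d p → MonicOfDeg e r → MonicOfDeg (d ℕ.+ e) (p *ₚ r)
  MonicOfDeg-*ₚ {p = p} {r} (cp≈1 , sp) (cr≈1 , sr) with *ₚ-Deg< {p = p} {r} (mkDeg< sp) (mkDeg< sr)
  ... | deg<-pr , top = trans top (trans (*-cong cp≈1 cr≈1) (*-identityˡ 1#)) , vanishes deg<-pr

  Monic⇒¬IsConstant : ∀ {d p} → 1 ≤ d → MonicOfDeg d p → ¬ IsConstant p
  Monic⇒¬IsConstant 1≤d (c≈1 , _) p-const = 1≉0 (trans (sym c≈1) (p-const _ 1≤d))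

module FiniteFieldProperties {m : ℕ} (L : FiniteField (suc m)) where
  open FiniteField L
  open import Algebra.Properties.Semiring.Mult semiring using (_×_; ×1-homo-*)
  open import Algebra.Properties.Semiring.Exp semiring using (_^_)
  open import Algebra.Properties.Ring ring using (+-identityʳ-unique; //-rightDividesˡ; //-rightDividesʳ)

  private
    to : Carrier → Fin (suc m)
    to = Inverse.to counting

    from : Fin (suc m) → Carrier
    from = Inverse.from counting

    from-to : ∀ x → from (to x) ≈ x
    from-to x = Inverse.inverseʳ counting ≡.refl

    to-from : ∀ i → to (from i) ≡ i
    to-from i = Inverse.inverseˡ counting refl

    to-cong : ∀ {x y} → x ≈ y → to x ≡ to y
    to-cong = Inverse.to-cong counting

  infix 4 _≟_
  _≟_ : Decidable _≈_
  x ≟ y with to x Fin.≟ to y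
  ... | yes e = yes (trans (sym (from-to x)) (trans (Inverse.from-cong counting e) (from-to y)))
  ... | no ne = no λ e → ne (to-cong e)

  decidableField : DecidableField
  decidableField = record { cring = cring ; 0≉1 = 0≉1 ; inverse = inverse ; _≟_ = _≟_ }

  open DecidableField decidableField using (1≉0; x≉0∧y≉0⇒x*y≉0)

  module Reindex (M : CommutativeMonoid 0ℓ 0ℓ) where
    open CommutativeMonoid M using () renaming (Carrier to A; _≈_ to _≈ᴹ_; trans to transᴹ)
    open Sum M using (sum; sum-permute; sum-cong-≋)

    sum-bijection : (h : Carrier → A) → (∀ {x y} → x ≈ y → h x ≈ᴹ h y) →
      (f f⁻¹ : Carrier → Carrier) →
      (∀ {x y} → x ≈ y → f x ≈ f y) → (∀ {x y} → x ≈ y → f⁻¹ x ≈ f⁻¹ y) →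
      (∀ x → f (f⁻¹ x) ≈ x) → (∀ x → f⁻¹ (f x) ≈ x) →
      sum (λ i → h (from i)) ≈ᴹ sum (λ i → h (f (from i)))
    sum-bijection h h-cong f f⁻¹ f-cong f⁻¹-cong ff⁻¹ f⁻¹f =
      transᴹ (sum-permute (λ i → h (from i)) π) (sum-cong-≋ λ i → h-cong (from-to (f (from i))))
      where
      π : Permutation (suc m) (suc m)
      π = permutation (λ i → to (f (from i))) (λ i → to (f⁻¹ (from i)))
        (λ i → ≡.trans (to-cong (trans (f-cong (from-to _)) (ff⁻¹ (from i)))) (to-from i))
        (λ i → ≡.trans (to-cong (trans (f⁻¹-cong (from-to _)) (f⁻¹f (from i)))) (to-from i))

  characteristic : suc m × 1# ≈ 0#
  characteristic = +-identityʳ-unique S (suc m × 1#) (sym (begin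
    S                          ≈⟨ sum-bijection id id (_+ 1#) (_- 1#) +-congʳ +-congʳ
                                    (//-rightDividesˡ 1#) (//-rightDividesʳ 1#) ⟩
    ∑ (λ i → from i + 1#)      ≈⟨ ∑-distrib-+ from (λ _ → 1#) ⟩
    S + ∑ {suc m} (λ _ → 1#)   ≈⟨ +-congˡ (sum-replicate (suc m)) ⟩
    S + suc m × 1#             ∎))
    where
    open Relation.Binary.Reasoning.Setoid setoid
    open Reindex +-commutativeMonoid
    open Sum +-commutativeMonoid using (∑-distrib-+; sum-replicate) renaming (sum to ∑)
    open import Function.Base using (id)
    S = ∑ from

  prime-characteristic : ∀ {p k} → suc m ≡ p ℕ.^ k → p × 1# ≈ 0#
  prime-characteristic {p} {k} m+1≡p^k with p × 1# ≟ 0#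
  ... | yes p×1≈0 = p×1≈0
  ... | no  p×1≉0 = ⊥-elim (x^n≉0 k (begin
    (p × 1#) ^ k       ≈⟨ ×1-^ k ⟨
    (p ℕ.^ k) × 1#     ≡⟨ ≡.cong (_× 1#) (≡.sym m+1≡p^k) ⟩
    suc m × 1#         ≈⟨ characteristic ⟩
    0#                 ∎))
    where
    open Relation.Binary.Reasoning.Setoid setoid
    ×1-^ : ∀ n → (p ℕ.^ n) × 1# ≈ (p × 1#) ^ n
    ×1-^ zero    = +-identityʳ 1#
    ×1-^ (suc n) = trans (×1-homo-* p (p ℕ.^ n)) (*-congˡ (×1-^ n))
    x^n≉0 : ∀ n → ¬ ((p × 1#) ^ n ≈ 0#)
    x^n≉0 zero    = 1≉0
    x^n≉0 (suc n) = x≉0∧y≉0⇒x*y≉0 p×1≉0 (x^n≉0 n)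

  open Sum *-commutativeMonoid using () renaming (sum to ∏)

  zeroToOne : Carrier → Carrier
  zeroToOne x with x ≟ 0#
  ... | yes _ = 1#
  ... | no  _ = x

  zeroToOne≉0 : ∀ x → ¬ (zeroToOne x ≈ 0#)
  zeroToOne≉0 x with x ≟ 0#
  ... | yes _   = 1≉0
  ... | no  x≉0 = x≉0

  zeroToOne-cong : ∀ {x y} → x ≈ y → zeroToOne x ≈ zeroToOne y
  zeroToOne-cong {x} {y} x≈y with x ≟ 0# | y ≟ 0#
  ... | yes _   | yes _   = refl
  ... | yes x≈0 | no  y≉0 = ⊥-elim (y≉0 (trans (sym x≈y) x≈0))
  ... | no  x≉0 | yes y≈0 = ⊥-elim (x≉0 (trans x≈y y≈0))
  ... | no  _   | no  _   = x≈y

  ∏-≉0 : ∀ k (f : Fin k → Carrier) → (∀ i → ¬ (f i ≈ 0#)) → ¬ (∏ f ≈ 0#)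
  ∏-≉0 zero    f nz = 1≉0
  ∏-≉0 (suc k) f nz = x≉0∧y≉0⇒x*y≉0 (nz Fin.zero) (∏-≉0 k (λ i → f (Fin.suc i)) (λ i → nz (Fin.suc i)))

  -- For a ≉ 0, multiplication by a permutes the field and fixes 0, so the
  -- product P of all elements (with 0 replaced by 1) satisfies P ≈ a^m * P.
  module _ (a : Carrier) (a≉0 : ¬ (a ≈ 0#)) where
    open Sum *-commutativeMonoid using (sum-remove; sum-cong-≋; ∑-distrib-+; sum-replicate)
    open import Function.Base using (_∘_)
    open Reindex *-commutativeMonoid
    open Relation.Binary.Reasoning.Setoid setoid

    scaling : Carrier → Carrier
    scaling x with x ≟ 0#
    ... | yes _ = 1#
    ... | no  _ = a

    zeroToOne-* : ∀ x → zeroToOne (a * x) ≈ scaling x * zeroToOne x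
    zeroToOne-* x with x ≟ 0# | (a * x) ≟ 0#
    ... | yes _   | yes _    = sym (*-identityˡ 1#)
    ... | yes x≈0 | no  ax≉0 = ⊥-elim (ax≉0 (trans (*-congˡ x≈0) (zeroʳ a)))
    ... | no  x≉0 | yes ax≈0 = ⊥-elim (x≉0∧y≉0⇒x*y≉0 a≉0 x≉0 ax≈0)
    ... | no  _   | no  _    = refl

    ∏-scaling : ∏ (λ i → scaling (from i)) ≈ a ^ m
    ∏-scaling = begin
      ∏ (λ i → scaling (from i))                        ≈⟨ sum-remove {i = to 0#} (λ i → scaling (from i)) ⟩
      scaling (from (to 0#)) * ∏ (λ j → scaling (from (Fin.punchIn (to 0#) j)))
                                                        ≈⟨ *-cong at-0 (sum-cong-≋ elsewhere) ⟩
      1# * ∏ {m} (λ _ → a)                              ≈⟨ *-identityˡ _ ⟩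
      ∏ {m} (λ _ → a)                                   ≈⟨ sum-replicate m ⟩
      a ^ m                                             ∎
      where
      at-0 : scaling (from (to 0#)) ≈ 1#
      at-0 with from (to 0#) ≟ 0#
      ... | yes _ = refl
      ... | no  z≉0 = ⊥-elim (z≉0 (from-to 0#))
      elsewhere : ∀ j → scaling (from (Fin.punchIn (to 0#) j)) ≈ a
      elsewhere j with from (Fin.punchIn (to 0#) j) ≟ 0#
      ... | yes z≈0 = ⊥-elim (Fin.punchInᵢ≢i (to 0#) j (≡.trans (≡.sym (to-from _)) (to-cong z≈0)))
      ... | no  _   = refl

    a^m≈1 : a ^ m ≈ 1#
    a^m≈1 = begin
      a ^ m               ≈⟨ *-identityʳ _ ⟨
      a ^ m * 1#          ≈⟨ *-congˡ PP⁻¹ ⟨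
      a ^ m * (P * P⁻¹)   ≈⟨ *-assoc _ _ _ ⟨
      (a ^ m * P) * P⁻¹   ≈⟨ *-congʳ P≈a^mP ⟨
      P * P⁻¹             ≈⟨ PP⁻¹ ⟩
      1#                  ∎
      where
      P = ∏ (λ i → zeroToOne (from i))
      P≈a^mP : P ≈ a ^ m * P
      P≈a^mP = begin
        P                                                   ≈⟨ sum-bijection zeroToOne zeroToOne-cong (a *_) (a⁻¹ *_)
                                                                 *-congˡ *-congˡ cancel cancel′ ⟩
        ∏ (λ i → zeroToOne (a * from i))                    ≈⟨ sum-cong-≋ (λ i → zeroToOne-* (from i)) ⟩
        ∏ (λ i → scaling (from i) * zeroToOne (from i))     ≈⟨ ∑-distrib-+ (scaling ∘ from) (zeroToOne ∘ from) ⟩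
        ∏ (λ i → scaling (from i)) * P                      ≈⟨ *-congʳ ∏-scaling ⟩
        a ^ m * P                                           ∎
        where
        a⁻¹ = proj₁ (inverse a a≉0)
        aa⁻¹ = proj₂ (inverse a a≉0)
        cancel : ∀ x → a * (a⁻¹ * x) ≈ x
        cancel x = trans (sym (*-assoc a a⁻¹ x)) (trans (*-congʳ aa⁻¹) (*-identityˡ x))
        cancel′ : ∀ x → a⁻¹ * (a * x) ≈ x
        cancel′ x = trans (sym (*-assoc a⁻¹ a x)) (trans (*-congʳ (trans (*-comm a⁻¹ a) aa⁻¹)) (*-identityˡ x))
      P⁻¹ = proj₁ (inverse P (∏-≉0 (suc m) _ (λ i → zeroToOne≉0 (from i))))
      PP⁻¹ = proj₂ (inverse P (∏-≉0 (suc m) _ (λ i → zeroToOne≉0 (from i))))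

  fermat : ∀ x → x ^ suc m ≈ x
  fermat x with x ≟ 0#
  ... | yes x≈0 = trans (*-congʳ x≈0) (trans (zeroˡ _) (sym x≈0))
  ... | no  x≉0 = trans (*-congˡ (a^m≈1 x x≉0)) (*-identityʳ x)

module BinomialCoefficients where
  open import Data.Nat using (_!)
  open import Data.Nat.Combinatorics using (_C_; k![n∸k]!∣n!)
  open import Data.Nat.Combinatorics.Specification using (nCk≡n!/k![n-k]!)
  open import Data.Nat.Divisibility using (_∣_; _∤_; ∣1⇒≡1; ∣⇒≤; m∣m*n)
  open import Data.Nat.DivMod using (m*[n/m]≡n)

  prime∤! : ∀ {p} → Prime p → ∀ m → m < p → p ∤ m !
  prime∤! p-prime zero    _   p∣1 with ∣1⇒≡1 p∣1
  ... | ≡.refl = ¬prime[1] p-prime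
  prime∤! p-prime (suc m) m<p p∣m! with euclidsLemma (suc m) (m !) p-prime p∣m!
  ... | inj₁ p∣1+m = ℕ.<⇒≱ m<p (∣⇒≤ p∣1+m)
  ... | inj₂ p∣m!  = prime∤! p-prime m (ℕ.<-trans (ℕ.n<1+n m) m<p) p∣m!

  p∣k![p∸k]!*pCk : ∀ {p k} → k < p → p ∣ (k ! ℕ.* (p ℕ.∸ k) !) ℕ.* (p C k)
  p∣k![p∸k]!*pCk {suc p} {k} k<p = ≡.subst (suc p ∣_) k![p∸k]!*pCk≡p! (m∣m*n (p !))
    where
    instance _ = k ℕ.!* (suc p ℕ.∸ k) !≢0
    k≤p = ℕ.<⇒≤ k<p
    k![p∸k]!*pCk≡p! : suc p ! ≡ (k ! ℕ.* (suc p ℕ.∸ k) !) ℕ.* (suc p C k)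
    k![p∸k]!*pCk≡p! = ≡.sym (≡.trans (≡.cong ((k ! ℕ.* (suc p ℕ.∸ k) !) ℕ.*_) (nCk≡n!/k![n-k]! k≤p))
                                     (m*[n/m]≡n (k![n∸k]!∣n! k≤p)))

  prime∣C : ∀ {p k} → Prime p → 0 < k → k < p → p ∣ p C k
  prime∣C {p} {k} p-prime 0<k k<p
    with euclidsLemma (k ! ℕ.* (p ℕ.∸ k) !) (p C k) p-prime (p∣k![p∸k]!*pCk k<p)
  ... | inj₂ p∣pCk = p∣pCk
  ... | inj₁ p∣k![p-k]! with euclidsLemma (k !) ((p ℕ.∸ k) !) p-prime p∣k![p-k]!
  ...   | inj₁ p∣k!     = ⊥-elim (prime∤! p-prime k k<p p∣k!)
  ...   | inj₂ p∣[p-k]! = ⊥-elim (prime∤! p-prime (p ℕ.∸ k) (ℕ.∸-monoʳ-< 0<k (ℕ.<⇒≤ k<p)) p∣[p-k]!)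

module Frobenius (R : CommutativeRing 0ℓ 0ℓ) where
  open CommutativeRing R
  open BinomialCoefficients using (prime∣C)
  open import Data.Nat.Combinatorics using (_C_; nCn≡1)
  open import Data.Nat.Divisibility using (divides)
  open import Data.Fin using (inject₁; fromℕ)
  open import Data.Vec.Functional using (init; tail)
  open import Algebra.Properties.Semiring.Mult semiring using (_×_; ×1-homo-*; ×-assoc-*; ×-congʳ)
  open import Algebra.Properties.Semiring.Exp semiring using (_^_; ^-assocʳ; ^-congˡ)
  open import Algebra.Properties.Semiring.Sum semiring using (sum; sum-cong-≋; sum-init-last; sum-replicate-zero)
  import Algebra.Properties.CommutativeSemiring.Binomial commutativeSemiring as Binomial

  open Relation.Binary.Reasoning.Setoid setoid

  multiple×≈0 : ∀ {p} → p × 1# ≈ 0# → ∀ c z → (c ℕ.* p) × z ≈ 0#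
  multiple×≈0 {p} p×1≈0 c z = begin
    (c ℕ.* p) × z               ≈⟨ ×-congʳ (c ℕ.* p) (*-identityˡ z) ⟨
    (c ℕ.* p) × (1# * z)        ≈⟨ ×-assoc-* (c ℕ.* p) 1# z ⟨
    ((c ℕ.* p) × 1#) * z        ≈⟨ *-congʳ (×1-homo-* c p) ⟩
    ((c × 1#) * (p × 1#)) * z   ≈⟨ *-congʳ (trans (*-congˡ p×1≈0) (zeroʳ _)) ⟩
    0# * z                      ≈⟨ zeroˡ z ⟩
    0#                          ∎

  -- In the binomial expansion of (x + y)^p only the two extreme terms survive.
  frobenius-+ : ∀ {p} → Prime p → p × 1# ≈ 0# → ∀ x y → (x + y) ^ p ≈ x ^ p + y ^ p
  frobenius-+ {zero}              p-prime = ⊥-elim (¬prime[0] p-prime)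
  frobenius-+ {suc zero}          p-prime = ⊥-elim (¬prime[1] p-prime)
  frobenius-+ {p@(suc (suc k))}   p-prime p×1≈0 x y = begin
    (x + y) ^ p                                          ≈⟨ Binomial.theorem p x y ⟩
    t Fin.zero + sum (tail t)                            ≈⟨ +-congˡ (sum-init-last (tail t)) ⟩
    t Fin.zero + (sum (init (tail t)) + t (fromℕ p))     ≈⟨ +-cong first-term (+-cong middle-terms last-term) ⟩
    y ^ p + (0# + x ^ p)                                 ≈⟨ trans (+-congˡ (+-identityˡ _)) (+-comm _ _) ⟩
    x ^ p + y ^ p                                        ∎
    where
    t = Binomial.binomialTerm x y p
    first-term : t Fin.zero ≈ y ^ p
    first-term = trans (+-identityʳ _) (*-identityˡ _)
    middle-terms : sum (init (tail t)) ≈ 0#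
    middle-terms = trans (sum-cong-≋ vanishes) (sum-replicate-zero (suc k))
      where
      vanishes : ∀ j → init (tail t) j ≈ 0#
      vanishes j with prime∣C p-prime (s≤s z≤n)
        (≡.subst (λ z → suc z < p) (≡.sym (Fin.toℕ-inject₁ j)) (s≤s (Fin.toℕ<n j)))
      ... | divides c pCj≡c*p = trans
        (reflexive (≡.cong (_× Binomial.binomial x y p (Fin.suc (inject₁ j))) pCj≡c*p))
        (multiple×≈0 p×1≈0 c _)
    last-term : t (fromℕ p) ≈ x ^ p
    last-term = at-p (fromℕ p) (Fin.toℕ-fromℕ p)
      where
      at-p : ∀ i → Fin.toℕ i ≡ p → t i ≈ x ^ p
      at-p i i≡p rewrite i≡p | nCn≡1 p | ℕ.n∸n≡0 p = trans (+-identityʳ _) (*-identityʳ _)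

  frobenius^-+ : ∀ {p} → Prime p → p × 1# ≈ 0# → ∀ j x y → (x + y) ^ (p ℕ.^ j) ≈ x ^ (p ℕ.^ j) + y ^ (p ℕ.^ j)
  frobenius^-+         p-prime p×1≈0 zero    x y = trans (*-identityʳ _) (sym (+-cong (*-identityʳ x) (*-identityʳ y)))
  frobenius^-+ {p = p} p-prime p×1≈0 (suc j) x y = begin
    (x + y) ^ (p ℕ.* p ℕ.^ j)                      ≈⟨ ^-assocʳ (x + y) p (p ℕ.^ j) ⟨
    ((x + y) ^ p) ^ (p ℕ.^ j)                      ≈⟨ ^-congˡ (p ℕ.^ j) (frobenius-+ p-prime p×1≈0 x y) ⟩
    (x ^ p + y ^ p) ^ (p ℕ.^ j)                    ≈⟨ frobenius^-+ p-prime p×1≈0 j (x ^ p) (y ^ p) ⟩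
    (x ^ p) ^ (p ℕ.^ j) + (y ^ p) ^ (p ℕ.^ j)      ≈⟨ +-cong (^-assocʳ x p (p ℕ.^ j)) (^-assocʳ y p (p ℕ.^ j)) ⟩
    x ^ (p ℕ.* p ℕ.^ j) + y ^ (p ℕ.* p ℕ.^ j)      ∎

module FactorLists (R : CommutativeRing 0ℓ 0ℓ) where
  open CommutativeRing R
  open PolynomialRing R
  open IntegerCoefficientSolver commutativeRing using (solve; _:=_; _:*_)

  record Factor : Set where
    constructor factor
    field
      degree : ℕ
      pol    : Pol
      symbol : Carrier
  open Factor public

  ∏ₚ : List Factor → Pol
  ∏ₚ []       = const 1#
  ∏ₚ (x ∷ xs) = pol x *ₚ ∏ₚ xs

  ∏χ : List Factor → Carrier
  ∏χ []       = 1#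
  ∏χ (x ∷ xs) = symbol x * ∏χ xs

  module _ {P : Factor → Set} where

    ∏ₚ-─ : ∀ {xs} (i : Any P xs) → ∏ₚ xs ≋ (pol (Any.lookup i) *ₚ ∏ₚ (xs ─ i))
    ∏ₚ-─ (here _) = ≋-refl
    ∏ₚ-─ {x ∷ xs} (there i) = ≋-trans (*ₚ-congˡ (pol x) (∏ₚ-─ i))
      (solve 3 (λ x y r → (x :* (y :* r)) := (y :* (x :* r))) ≋-refl (pol x) (pol (Any.lookup i)) (∏ₚ (xs ─ i)))

    ∏χ-─ : ∀ {xs} (i : Any P xs) → ∏χ xs ≈ symbol (Any.lookup i) * ∏χ (xs ─ i)
    ∏χ-─ (here _) = refl
    ∏χ-─ {x ∷ xs} (there i) = trans (*-congˡ (∏χ-─ i)) (x∙yz≈y∙xz (symbol x) _ _)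
      where open import Algebra.Properties.CommutativeSemigroup *-commutativeSemigroup using (x∙yz≈y∙xz)

  factorProduct : List Entry → Pol
  factorProduct = foldr (λ e acc → (fac e ^ₚ ex e) *ₚ acc) (const 1#)

  expand : List Entry → List Factor
  expand []       = []
  expand (e ∷ es) = replicate (ex e) (factor (deg e) (fac e) (val e)) ++ expand es

  ∏ₚ-replicate-++ : ∀ n x xs → ∏ₚ (replicate n x ++ xs) ≋ ((pol x ^ₚ n) *ₚ ∏ₚ xs)
  ∏ₚ-replicate-++ zero    x xs = ≋-sym (*ₚ-identityˡ _)
  ∏ₚ-replicate-++ (suc n) x xs =
    ≋-trans (*ₚ-congˡ (pol x) (∏ₚ-replicate-++ n x xs)) (≋-sym (*ₚ-assoc (pol x) _ _))

  ∏ₚ-expand : ∀ es → ∏ₚ (expand es) ≋ factorProduct es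
  ∏ₚ-expand []       = ≋-refl
  ∏ₚ-expand (e ∷ es) = ≋-trans (∏ₚ-replicate-++ (ex e) _ (expand es)) (*ₚ-congˡ (fac e ^ₚ ex e) (∏ₚ-expand es))

  ∏χ-replicate-++ : ∀ n x xs → ∏χ (replicate n x ++ xs) ≈ (symbol x ^ᵣ n) * ∏χ xs
  ∏χ-replicate-++ zero    x xs = sym (*-identityˡ _)
  ∏χ-replicate-++ (suc n) x xs = trans (*-congˡ (∏χ-replicate-++ n x xs)) (sym (*-assoc (symbol x) _ _))

  ∏χ-expand : ∀ es → ∏χ (expand es) ≈ chiProduct es
  ∏χ-expand []       = refl
  ∏χ-expand (e ∷ es) = trans (∏χ-replicate-++ (ex e) _ (expand es)) (*-congˡ (∏χ-expand es))

  ∣^ₚ : ∀ g n → 1 ≤ n → g ∣ (g ^ₚ n)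
  ∣^ₚ g (suc n) _ = ∣-*ʳ (g ^ₚ n) ∣-refl

  fac∣factorProduct : ∀ es → All (λ e → 1 ≤ ex e) es → All (λ e → fac e ∣ factorProduct es) es
  fac∣factorProduct []       []            = []
  fac∣factorProduct (e ∷ es) (1≤ex ∷ 1≤exs) =
    ∣-*ʳ (factorProduct es) (∣^ₚ (fac e) (ex e) 1≤ex) ∷
    All.map (x∣ʳy⇒x∣ʳzy (fac e ^ₚ ex e)) (fac∣factorProduct es 1≤exs)

module Conjugation (K : DecidableField) (q : ℕ) where
  open import Data.Product using (_×_)
  open DecidableField K
  open Exponentiation cring
  open PolynomialsOverField K
  open FactorLists cring
  open import Algebra.Properties.CommutativeSemiring.Exp commutativeSemiring
    using (_^_; ^-congˡ; ^-distrib-*)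
  open import Algebra.Properties.Ring ring using (x+x≈x⇒x≈0; +-inverseʳ-unique)
  open IntegerCoefficientSolver commutativeRing using (solve; _:=_; _:*_)

  σ : Carrier → Carrier
  σ x = x ^ q

  σₚ : Pol → Pol
  σₚ = map σ

  Fixed : Pol → Set
  Fixed p = σₚ p ≋ p

  FixedDivisor : Pol → Pol → Set
  FixedDivisor g A = Σ Pol λ h → Fixed h × A ≋ (g *ₚ h)

  FixedCoprime : Pol → Pol → Set
  FixedCoprime D F = ∀ g → Fixed g → FixedDivisor g D → FixedDivisor g F → IsConstant g

  PolFq⇒Fixed : ∀ {p} → PolFq q p → Fixed p
  PolFq⇒Fixed []              = ≋-refl
  PolFq⇒Fixed (a^q≈a ∷ p∈Fq) = ∷-cong (trans (sym (^ᵣ≈^ _ q)) a^q≈a) (PolFq⇒Fixed p∈Fq)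

  Fixed⇒PolFq : ∀ p → Fixed p → PolFq q p
  Fixed⇒PolFq []      _     = []
  Fixed⇒PolFq (a ∷ p) fixed =
    trans (^ᵣ≈^ a q) (at fixed 0) ∷ Fixed⇒PolFq p (mk≋ λ n → at fixed (suc n))

  CoprimeFq⇒FixedCoprime : ∀ {D F} → CoprimeFq q D F → FixedCoprime D F
  CoprimeFq⇒FixedCoprime coprime g σg≈g (h , σh≈h , D≈gh) (h′ , σh′≈h′ , F≈gh′) = coprime g
    (Fixed⇒PolFq g σg≈g) (h , Fixed⇒PolFq h σh≈h , at D≈gh) (h′ , Fixed⇒PolFq h′ σh′≈h′ , at F≈gh′)

  module Automorphism (σ-+ : ∀ x y → σ (x + y) ≈ σ x + σ y) (σ-involutive : ∀ x → σ (σ x) ≈ x) where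

    σ-cong : ∀ {x y} → x ≈ y → σ x ≈ σ y
    σ-cong = ^-congˡ q

    σ-* : ∀ x y → σ (x * y) ≈ σ x * σ y
    σ-* x y = ^-distrib-* x y q

    σ-1# : σ 1# ≈ 1#
    σ-1# = 1#^n≈1# q

    σ-0# : σ 0# ≈ 0#
    σ-0# = x+x≈x⇒x≈0 (σ 0#) (trans (sym (σ-+ 0# 0#)) (σ-cong (+-identityʳ 0#)))

    σ-‿ : ∀ x → σ (- x) ≈ - σ x
    σ-‿ x = +-inverseʳ-unique (σ x) (σ (- x))
      (trans (sym (σ-+ x (- x))) (trans (σ-cong (-‿inverseʳ x)) σ-0#))

    σ-injective : ∀ {x y} → σ x ≈ σ y → x ≈ y
    σ-injective {x} {y} e = trans (sym (σ-involutive x)) (trans (σ-cong e) (σ-involutive y))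

    coeff-σₚ : ∀ p n → coeff (σₚ p) n ≈ σ (coeff p n)
    coeff-σₚ []      n       = sym σ-0#
    coeff-σₚ (a ∷ p) zero    = refl
    coeff-σₚ (a ∷ p) (suc n) = coeff-σₚ p n

    σₚ-cong : ∀ {p r} → p ≋ r → σₚ p ≋ σₚ r
    σₚ-cong {p} {r} e = mk≋ λ n → trans (coeff-σₚ p n) (trans (σ-cong (at e n)) (sym (coeff-σₚ r n)))

    σₚ-involutive : ∀ p → σₚ (σₚ p) ≋ p
    σₚ-involutive p = mk≋ λ n → trans (coeff-σₚ (σₚ p) n) (trans (σ-cong (coeff-σₚ p n)) (σ-involutive _))

    σₚ-+ₚ : ∀ p r → σₚ (p +ₚ r) ≋ (σₚ p +ₚ σₚ r)
    σₚ-+ₚ p r = mk≋ λ n → trans (coeff-σₚ (p +ₚ r) n) (trans (σ-cong (coeff-+ₚ p r n)) (trans (σ-+ _ _)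
      (sym (trans (coeff-+ₚ (σₚ p) (σₚ r) n) (+-cong (coeff-σₚ p n) (coeff-σₚ r n))))))

    σₚ-negₚ : ∀ p → σₚ (-ₚ p) ≋ (-ₚ σₚ p)
    σₚ-negₚ p = mk≋ λ n → trans (coeff-σₚ (-ₚ p) n) (trans (σ-cong (coeff-negₚ p n)) (trans (σ-‿ _)
      (sym (trans (coeff-negₚ (σₚ p) n) (-‿cong (coeff-σₚ p n))))))

    σₚ-· : ∀ c p → σₚ (c · p) ≋ (σ c · σₚ p)
    σₚ-· c p = mk≋ λ n → trans (coeff-σₚ (c · p) n) (trans (σ-cong (coeff-· c p n)) (trans (σ-* _ _)
      (sym (trans (coeff-· (σ c) (σₚ p) n) (*-congˡ (coeff-σₚ p n))))))

    σₚ-*ₚ : ∀ p r → σₚ (p *ₚ r) ≋ (σₚ p *ₚ σₚ r)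
    σₚ-*ₚ []      r = ≋-refl
    σₚ-*ₚ (a ∷ p) r = ≋-trans (σₚ-+ₚ (a · r) (shift (p *ₚ r)))
      (+ₚ-cong (σₚ-· a r) (∷-cong σ-0# (σₚ-*ₚ p r)))

    σₚ-^ₚ : ∀ p n → σₚ (p ^ₚ n) ≋ (σₚ p ^ₚ n)
    σₚ-^ₚ p zero    = const-cong σ-1#
    σₚ-^ₚ p (suc n) = ≋-trans (σₚ-*ₚ p (p ^ₚ n)) (*ₚ-congˡ (σₚ p) (σₚ-^ₚ p n))

    σₚ-∣ : ∀ {g a} → g ∣ a → σₚ g ∣ σₚ a
    σₚ-∣ {g} (h , hg≈a) = σₚ h , ≋-trans (≋-sym (σₚ-*ₚ h g)) (σₚ-cong hg≈a)

    σₚ-MonicOfDeg : ∀ {d p} → MonicOfDeg d p → MonicOfDeg d (σₚ p)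
    σₚ-MonicOfDeg {d} {p} (c≈1 , above) =
      trans (coeff-σₚ p d) (trans (σ-cong c≈1) σ-1#) ,
      λ n d<n → trans (coeff-σₚ p n) (trans (σ-cong (above n d<n)) σ-0#)

    σₚ-IsConstant⁻ : ∀ g → IsConstant (σₚ g) → IsConstant g
    σₚ-IsConstant⁻ g c n 1≤n = σ-injective (trans (sym (coeff-σₚ g n)) (trans (c n 1≤n) (sym σ-0#)))

    σₚ-MonicIrreducible : ∀ {d π} → MonicIrreducible d π → MonicIrreducible d (σₚ π)
    σₚ-MonicIrreducible {d} {π} (1≤d , m , irr) = 1≤d , σₚ-MonicOfDeg {p = π} m , irr′
      where
      irr′ : ∀ g h → σₚ π ≈ₚ (g *ₚ h) → IsConstant g ⊎ IsConstant h
      irr′ g h e with irr (σₚ g) (σₚ h)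
        (at (≋-trans (≋-sym (σₚ-involutive π)) (≋-trans (σₚ-cong (mk≋ e)) (σₚ-*ₚ g h))))
      ... | inj₁ c = inj₁ (σₚ-IsConstant⁻ g c)
      ... | inj₂ c = inj₂ (σₚ-IsConstant⁻ h c)

    Fixed-cofactor : ∀ {g h} → Fixed g → ¬ (g ≋ []) → Fixed (g *ₚ h) → Fixed h
    Fixed-cofactor {g} {h} σg≈g g≉0 σgh≈gh = *ₚ-cancelˡ g≉0
      (≋-trans (*ₚ-congʳ (σₚ h) (≋-sym σg≈g)) (≋-trans (≋-sym (σₚ-*ₚ g h)) σgh≈gh))

    Fixed-*ₚ-conjugate : ∀ π → Fixed (π *ₚ σₚ π)
    Fixed-*ₚ-conjugate π = ≋-trans (σₚ-*ₚ π (σₚ π))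
      (≋-trans (*ₚ-congˡ (σₚ π) (σₚ-involutive π)) (*ₚ-comm (σₚ π) π))

    conjugate≉⇒∤ : ∀ {d π} → MonicIrreducible d π → ¬ (σₚ π ≋ π) → ¬ (σₚ π ∣ π)
    conjugate≉⇒∤ {π = π} mi σπ≉π σπ∣π =
      σπ≉π (MonicIrreducible-∣⇒≋ (σₚ-MonicIrreducible {π = π} mi) mi σπ∣π)

    -- The irreducible of the σ-fixed subring divisible by π: π if σπ ≈ π, and π σπ otherwise.
    record Norm (d : ℕ) (π : Pol) : Set where
      field
        N : Pol
        N-fixed : Fixed N
        N-nonconstant : ¬ IsConstant N
        N-∣ : ∀ {A} → Fixed A → π ∣ A → N ∣ A

    norm : ∀ {d π} → MonicIrreducible d π → Norm d π
    norm {d} {π} mi@(1≤d , m , _) with σₚ π ≋? π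
    ... | yes σπ≈π = record
      { N = π ; N-fixed = σπ≈π ; N-nonconstant = Monic⇒¬IsConstant {p = π} 1≤d m ; N-∣ = λ _ π∣A → π∣A }
    ... | no  σπ≉π = record
      { N = π *ₚ σₚ π
      ; N-fixed = Fixed-*ₚ-conjugate π
      ; N-nonconstant = Monic⇒¬IsConstant {p = π *ₚ σₚ π} (ℕ.≤-trans 1≤d (ℕ.m≤m+n d d))
                          (MonicOfDeg-*ₚ {p = π} m (σₚ-MonicOfDeg {p = π} m))
      ; N-∣ = πσπ-∣
      }
      where
      πσπ-∣ : ∀ {A} → Fixed A → π ∣ A → (π *ₚ σₚ π) ∣ A
      πσπ-∣ {A} σA≈A (h , hπ≈A) with euclid (σₚ-MonicIrreducible {π = π} mi)
        (∣ʳ-respʳ-≈ (≋-trans σA≈A (≋-trans (≋-sym hπ≈A) (*ₚ-comm h π))) (σₚ-∣ (h , hπ≈A)))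
      ... | inj₁ σπ∣π = ⊥-elim (conjugate≉⇒∤ mi σπ≉π σπ∣π)
      ... | inj₂ (k , kσπ≈h) = k , ≋-trans
        (solve 3 (λ K P S → (K :* (P :* S)) := ((K :* S) :* P)) ≋-refl k π (σₚ π))
        (≋-trans (*ₚ-congʳ π kσπ≈h) hπ≈A)

    Norm⇒FixedDivisor : ∀ {d π A} → (n : Norm d π) → Fixed A → π ∣ A → FixedDivisor (Norm.N n) A
    Norm⇒FixedDivisor {A = A} n σA≈A π∣A with Norm.N-∣ n σA≈A π∣A
    ... | h , hN≈A =
      h , Fixed-cofactor (Norm.N-fixed n) N≉0 (≋-trans (σₚ-cong (≋-sym A≈Nh)) (≋-trans σA≈A A≈Nh)) , A≈Nh
      where
      A≈Nh : A ≋ (Norm.N n *ₚ h)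
      A≈Nh = ≋-trans (≋-sym hN≈A) (*ₚ-comm h (Norm.N n))
      N≉0 : ¬ (Norm.N n ≋ [])
      N≉0 N≈0 = Norm.N-nonconstant n λ k _ → at N≈0 k

    FixedCoprime⇒∤ : ∀ {d π D F} → FixedCoprime D F → Fixed D → Fixed F →
      MonicIrreducible d π → π ∣ D → ¬ (π ∣ F)
    FixedCoprime⇒∤ coprime σD≈D σF≈F mi π∣D π∣F = Norm.N-nonconstant n
      (coprime (Norm.N n) (Norm.N-fixed n) (Norm⇒FixedDivisor n σD≈D π∣D) (Norm⇒FixedDivisor n σF≈F π∣F))
      where n = norm mi

    exponent : ℕ → ℕ
    exponent d = (q ℕ.^ (2 ℕ.* d) ℕ.∸ 1) ℕ./ 3

    -- For x = factor d π ω: ω = Ω(χ_π(F)) and χ_π(F) ≠ 0.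
    NonzeroSymbol : Pol → Factor → Set
    NonzeroSymbol F x = MonicIrreducible (degree x) (pol x) × (symbol x ^ᵣ 3) ≈ 1# ×
                        pol x ∣ ((F ^ₚ exponent (degree x)) -ₚ const (symbol x))

    cubeRoot≉0 : ∀ {ω} → (ω ^ᵣ 3) ≈ 1# → ¬ (ω ≈ 0#)
    cubeRoot≉0 ω³≈1 ω≈0 = 0≉1 (trans (sym (trans (*-congʳ ω≈0) (zeroˡ _))) ω³≈1)

    module CubicSymbols (σ-cube : ∀ ω → (ω ^ᵣ 3) ≈ 1# → σ ω ≈ ω * ω) {F : Pol} (σF≈F : Fixed F) where

      conjugate-residue : ∀ {x} → NonzeroSymbol F x →
        σₚ (pol x) ∣ ((F ^ₚ exponent (degree x)) -ₚ const (symbol x * symbol x))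
      conjugate-residue {factor d π ω} (_ , ω³≈1 , π∣) = ∣ʳ-respʳ-≈ σ-residue (σₚ-∣ π∣)
        where
        σ-residue : σₚ ((F ^ₚ exponent d) -ₚ const ω) ≋ ((F ^ₚ exponent d) -ₚ const (ω * ω))
        σ-residue = ≋-trans (σₚ-+ₚ (F ^ₚ exponent d) (-ₚ const ω))
          (+ₚ-cong (≋-trans (σₚ-^ₚ F (exponent d)) (^ₚ-cong (exponent d) σF≈F))
                   (≋-trans (σₚ-negₚ (const ω)) (-ₚ-cong (const-cong (σ-cube ω ω³≈1)))))

      conjugate-symbol : ∀ {x y} → NonzeroSymbol F x → NonzeroSymbol F y → σₚ (pol x) ≋ pol y →
        symbol y ≈ symbol x * symbol x
      conjugate-symbol {factor d π ω} {factor d′ π′ ω′}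
                       sx@((_ , m , _) , _) ((1≤d′ , m′ , _) , _ , π′∣) σπ≈π′
        with HasDegree-unique (HasDegree-cong σπ≈π′ (Monic⇒HasDegree (σₚ π) (σₚ-MonicOfDeg {p = π} m)))
                              (Monic⇒HasDegree π′ m′)
      ... | ≡.refl = sym (residue-unique 1≤d′ m′ (∣ʳ-respˡ-≈ σπ≈π′ (conjugate-residue sx)) π′∣)

      selfConjugate⇒symbol≈1 : ∀ {x} → NonzeroSymbol F x → Fixed (pol x) → symbol x ≈ 1#
      selfConjugate⇒symbol≈1 sx@(_ , ω³≈1 , _) σπ≈π =
        x≉0∧x*x≈x⇒x≈1 (cubeRoot≉0 ω³≈1) (sym (conjugate-symbol sx sx σπ≈π))

      pol≉[] : ∀ {x} → NonzeroSymbol F x → ¬ (pol x ≋ [])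
      pol≉[] {x} ((_ , m , _) , _) = Monic⇒≉[] (pol x) m

      irreducible∣∏ₚ⇒∈ : ∀ {d g} ys → MonicIrreducible d g → All (λ y → MonicIrreducible (degree y) (pol y)) ys →
        g ∣ ∏ₚ ys → Any (λ y → g ≋ pol y) ys
      irreducible∣∏ₚ⇒∈ []       (1≤d , m , _) []          g∣1 = ⊥-elim (Monic∤const 1≤d m 1≉0 g∣1)
      irreducible∣∏ₚ⇒∈ (y ∷ ys) mi           (miy ∷ mis) g∣ with euclid mi g∣
      ... | inj₁ g∣y    = here (MonicIrreducible-∣⇒≋ mi miy g∣y)
      ... | inj₂ g∣rest = there (irreducible∣∏ₚ⇒∈ ys mi mis g∣rest)

      conjugate∈ : ∀ {x} ys → NonzeroSymbol F x → All (NonzeroSymbol F) ys → ¬ Fixed (pol x) →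
        Fixed (pol x *ₚ ∏ₚ ys) → Any (λ y → σₚ (pol x) ≋ pol y) ys
      conjugate∈ {factor d π ω} ys (mi , _) sys σπ≉π fixed
        with euclid (σₚ-MonicIrreducible {π = π} mi) (∣ʳ-respʳ-≈ fixed (σₚ-∣ (∣-*ʳ (∏ₚ ys) ∣-refl)))
      ... | inj₁ σπ∣π = ⊥-elim (conjugate≉⇒∤ {π = π} mi σπ≉π σπ∣π)
      ... | inj₂ σπ∣∏ = irreducible∣∏ₚ⇒∈ ys (σₚ-MonicIrreducible {π = π} mi) (All.map proj₁ sys) σπ∣∏

      -- Factors come in conjugate pairs (π, σπ) with symbols (ω, ω²), or are
      -- self-conjugate with symbol 1; length xs ≤ n is the termination measure.
      ∏χ≈1 : ∀ n xs → length xs ≤ n → All (NonzeroSymbol F) xs → Fixed (∏ₚ xs) → ∏χ xs ≈ 1#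
      ∏χ≈1 _       []                  _         []         _     = refl
      ∏χ≈1 (suc n) (x@(factor d π ω) ∷ ys) (s≤s len) (sx ∷ sys) fixed with σₚ π ≋? π
      ... | yes σπ≈π = trans (*-cong (selfConjugate⇒symbol≈1 sx σπ≈π)
                                     (∏χ≈1 n ys len sys (Fixed-cofactor σπ≈π (pol≉[] sx) fixed)))
                             (*-identityˡ 1#)
      ... | no  σπ≉π = begin
        ω * ∏χ ys                ≈⟨ *-congˡ (∏χ-─ i) ⟩
        ω * (symbol y * ∏χ zs)   ≈⟨ *-congˡ (*-cong (conjugate-symbol sx sy σπ≈y)
                                                    (∏χ≈1 n zs zs≤n (─⁺ i sys) zs-fixed)) ⟩
        ω * ((ω * ω) * 1#)       ≈⟨ *-congˡ (trans (*-identityʳ _) (*-congˡ (sym (*-identityʳ ω)))) ⟩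
        ω ^ᵣ 3                   ≈⟨ proj₁ (proj₂ sx) ⟩
        1#                       ∎
        where
        open Relation.Binary.Reasoning.Setoid setoid
        i = conjugate∈ ys sx sys σπ≉π fixed
        y = Any.lookup i
        zs = ys ─ i
        sy = proj₁ (lookupAny sys i)
        σπ≈y = proj₂ (lookupAny sys i)
        zs≤n : length zs ≤ n
        zs≤n = ℕ.≤-trans (ℕ.n≤1+n _) (≡.subst (_≤ n) (List.length-removeAt′ ys (Any.index i)) len)
        πy-fixed : Fixed (π *ₚ pol y)
        πy-fixed = ≋-trans (σₚ-cong (*ₚ-congˡ π (≋-sym σπ≈y)))
                  (≋-trans (Fixed-*ₚ-conjugate π) (*ₚ-congˡ π σπ≈y))
        zs-fixed : Fixed (∏ₚ zs)
        zs-fixed = Fixed-cofactor πy-fixed (*ₚ-≉[] (pol≉[] sx) (pol≉[] sy))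
          (≋-trans (σₚ-cong (≋-sym x∷ys≈)) (≋-trans fixed x∷ys≈))
          where
          x∷ys≈ : (π *ₚ ∏ₚ ys) ≋ ((π *ₚ pol y) *ₚ ∏ₚ zs)
          x∷ys≈ = ≋-trans (*ₚ-congˡ π (∏ₚ-─ i)) (≋-sym (*ₚ-assoc π (pol y) (∏ₚ zs)))

      entry-symbol : ∀ {e} → MonicIrreducible (deg e) (fac e) → ¬ (fac e ∣ F) →
        ChiPi q (deg e) (fac e) F (val e) → NonzeroSymbol F (factor (deg e) (fac e) (val e))
      entry-symbol mi ∤F (inj₁ (π∣F , _))         = ⊥-elim (∤F (∣ₚ⇒∣ π∣F))
      entry-symbol mi ∤F (inj₂ (_ , ω³≈1 , π∣)) = mi , ω³≈1 , ∣ₚ⇒∣ π∣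

      expand-symbols : ∀ es → All (λ e → MonicIrreducible (deg e) (fac e) × ¬ (fac e ∣ F)) es →
        ChiValues q F es → All (NonzeroSymbol F) (expand es)
      expand-symbols []       []                []       = []
      expand-symbols (e ∷ es) ((mi , ∤F) ∷ rest) (χ ∷ χs) =
        ++⁺ (replicate⁺ (ex e) (entry-symbol {e} mi ∤F χ)) (expand-symbols es rest χs)

      chiProduct≈1 : ∀ {D} es → Fixed D → FixedCoprime D F → IsFactorization D es → ChiValues q F es →
        chiProduct es ≈ 1#
      chiProduct≈1 {D} es σD≈D coprime (irreducibles , _ , D≈) χs = begin
        chiProduct es   ≈⟨ ∏χ-expand es ⟨
        ∏χ (expand es)  ≈⟨ ∏χ≈1 _ (expand es) ℕ.≤-refl (expand-symbols es coprime-factors χs) fixed ⟩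
        1#              ∎
        where
        open Relation.Binary.Reasoning.Setoid setoid
        D≋∏ : D ≋ ∏ₚ (expand es)
        D≋∏ = ≋-trans (mk≋ D≈) (≋-sym (∏ₚ-expand es))
        fixed : Fixed (∏ₚ (expand es))
        fixed = ≋-trans (σₚ-cong (≋-sym D≋∏)) (≋-trans σD≈D D≋∏)
        coprime-factors : All (λ e → MonicIrreducible (deg e) (fac e) × ¬ (fac e ∣ F)) es
        coprime-factors = All.zipWith
          (λ { ((mi , _) , fac∣) →
                 mi , FixedCoprime⇒∤ coprime σD≈D σF≈F mi (∣ʳ-respʳ-≈ (≋-sym (mk≋ D≈)) fac∣) })
          (irreducibles , fac∣factorProduct es (All.map proj₂ irreducibles))

module FrobeniusOfQuadraticExtension {q′ : ℕ} (L : FiniteField (suc q′ ℕ.^ 2)) where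
  q = suc q′
  open FiniteField L
  open Exponentiation cring using (1#^n≈1#)
  open Poly cring using (_^ᵣ_)
  open FiniteFieldProperties L using (prime-characteristic; fermat)
  open import Algebra.Properties.Semiring.Exp semiring using (_^_; ^-homo-*; ^-assocʳ; ^-congʳ; ^-congˡ)
  open Relation.Binary.Reasoning.Setoid setoid

  module _ {p k : ℕ} (p-prime : Prime p) (q≡p^k : q ≡ p ℕ.^ k) where

    σ-+ : ∀ x y → (x + y) ^ q ≈ x ^ q + y ^ q
    σ-+ x y = ≡.subst (λ n → (x + y) ^ n ≈ x ^ n + y ^ n) (≡.sym q≡p^k)
      (Frobenius.frobenius^-+ cring p-prime (prime-characteristic {k = k ℕ.* 2} q²≡p^2k) k x y)
      where
      q²≡p^2k : q ℕ.^ 2 ≡ p ℕ.^ (k ℕ.* 2)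
      q²≡p^2k = ≡.trans (≡.cong (ℕ._^ 2) q≡p^k) (ℕ.^-*-assoc p k 2)

  σ-involutive : ∀ x → (x ^ q) ^ q ≈ x
  σ-involutive x = trans (^-assocʳ x q q) (trans (^-congʳ x (≡.cong (q ℕ.*_) (≡.sym (ℕ.*-identityʳ q)))) (fermat x))

  σ-cube : q % 3 ≡ 2 → ∀ ω → ω ^ᵣ 3 ≈ 1# → ω ^ q ≈ ω * ω
  σ-cube q%3≡2 ω ω³≈1 = begin
    ω ^ q                   ≡⟨ ≡.cong (ω ^_) q≡2+t*3 ⟩
    ω ^ (2 ℕ.+ t ℕ.* 3)     ≈⟨ ^-homo-* ω 2 (t ℕ.* 3) ⟩
    ω ^ 2 * ω ^ (t ℕ.* 3)   ≈⟨ *-cong (*-congˡ (*-identityʳ ω)) (^-congʳ ω (ℕ.*-comm t 3)) ⟩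
    ω * ω * ω ^ (3 ℕ.* t)   ≈⟨ *-congˡ (^-assocʳ ω 3 t) ⟨
    ω * ω * (ω ^ 3) ^ t     ≈⟨ *-congˡ (trans (^-congˡ t ω³≈1) (1#^n≈1# t)) ⟩
    ω * ω * 1#              ≈⟨ *-identityʳ _ ⟩
    ω * ω                   ∎
    where
    t = q / 3
    q≡2+t*3 : q ≡ 2 ℕ.+ t ℕ.* 3
    q≡2+t*3 = ≡.trans (m≡m%n+[m/n]*n q 3) (≡.cong (ℕ._+ t ℕ.* 3) q%3≡2)

mainTheorem2 : (q : ℕ) → IsPrimePower q → q % 2 ≡ 1 → q % 3 ≡ 2 →
    (L : FiniteField (q Data.Nat.^ 2)) →
    (D F : Poly.Pol (FiniteField.cring L)) →
    Poly.PolFq (FiniteField.cring L) q D → Poly.Monic (FiniteField.cring L) D →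
    Poly.PolFq (FiniteField.cring L) q F → Poly.Monic (FiniteField.cring L) F →
    Poly.CoprimeFq (FiniteField.cring L) q D F →
    (es : List (Poly.Entry (FiniteField.cring L))) →
    Poly.IsFactorization (FiniteField.cring L) D es →
    Poly.ChiValues (FiniteField.cring L) q F es →
    FiniteField._≈_ L (Poly.chiProduct (FiniteField.cring L) es) (FiniteField.1# L)
mainTheorem2 zero _ _ ()
mainTheorem2 (suc q′) (p , k , p-prime , _ , q≡p^k) _ q%3≡2 L D F D∈Fq _ F∈Fq _ coprime es factorisation χs =
  chiProduct≈1 es (PolFq⇒Fixed D∈Fq) (CoprimeFq⇒FixedCoprime coprime) factorisation χs
  where
  open FrobeniusOfQuadraticExtension {q′} L
  open FiniteFieldProperties L using (decidableField)
  open Conjugation decidableField (suc q′)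
  open Automorphism (σ-+ {k = k} p-prime q≡p^k) σ-involutive
  open CubicSymbols (σ-cube q%3≡2) (PolFq⇒Fixed F∈Fq)
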